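{- For all integers $n\ge2$, $$\mathsf{DExc}_n(s,t)=s\,\mathsf{DExc}_{n-1}(s,t)+t\,\mathsf{(B\text{ - }D)Exc}_{n-1}(s,t)+st\,D\,\mathsf{BExc}_{n-1}(s,t),$$ $$\mathsf{(B\text{ - }D)Exc}_n(s,t)=t\,\mathsf{DExc}_{n-1}(s,t)+s\,\mathsf{(B\text{ - }D)Exc}_{n-1}(s,t)+st\,D\,\mathsf{BExc}_{n-1}(s,t).$$
   Context: $\mathfrak{B}_n$ is the group of signed permutations of $\{\pm1,\dots,\pm n\}$ ($\pi(-i)=-\pi(i)$), $\pi_i=\pi(i)$; $\mathfrak{D}_n\subseteq\mathfrak{B}_n$ consists of those with an even number of negative entries among $\pi_1,\dots,\pi_n$. $\mathsf{exc}_B(\pi)=\mathsf{exc}_D(\pi)=|\{i\in[n]:\pi(|\pi(i)|)>\pi(i)\}|+|\{i\in[n]:\pi_i=-i\}|$, $\mathsf{nexc}=n-\mathsf{exc}$. $\mathsf{BExc}_n(s,t)=\sum_{\pi\in\mathfrak{B}_n}t^{\mathsf{exc}_B(\pi)}s^{\mathsf{nexc}_B(\pi)}$, $\mathsf{DExc}_n(s,t)=\sum_{\pi\in\mathfrak{D}_n}t^{\mathsf{exc}_D(\pi)}s^{\mathsf{nexc}_D(\pi)}$, $\mathsf{(B\text{ - }D)Exc}_n(s,t)=\sum_{\pi\in\mathfrak{B}_n\setminus\mathfrak{D}_n}t^{\mathsf{exc}_D(\pi)}s^{\mathsf{nexc}_D(\pi)}$. $D=\frac{\partial}{\partial s}+\frac{\partial}{\partial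 t}$. -}

module Defs where

open import Data.Bool using (Bool; true; false; _∧_; not; if_then_else_)
open import Data.Nat as ℕ using (ℕ; zero; suc; _∸_; _+_; _*_)
open import Data.Integer as ℤ using (ℤ; +_; -[1+_]; ∣_∣; -_)
import Data.Integer.Properties as ℤP
open import Data.List using (List; []; _∷_; map; concatMap; filterᵇ; length; upTo; zip)
open import Data.Bool.ListAction using (all; any)
open import Data.Product using (_×_; _,_)
open import Relation.Nullary.Decidable using (⌊_⌋)

-- Signed permutations
-- A signed permutation π of {±1,…,±n} (with π(-i) = -π(i)) is encoded by
-- its window [π_1, …, π_n], a list of integers.

vals : ℕ → List ℤ
vals n = concatMap (λ i → + (suc i) ∷ -[1+ i ] ∷ []) (upTo n)

words : ℕ → ℕ → List (List ℤ)
words zero    n = [] ∷ []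
words (suc k) n = concatMap (λ w → map (_∷ w) (vals n)) (words k n)

isSignedPerm : ℕ → List ℤ → Bool
isSignedPerm n w = all (λ i → any (λ x → ⌊ ∣ x ∣ ℕ.≟ suc i ⌋) w) (upTo n)

Bn : ℕ → List (List ℤ)
Bn n = filterᵇ (isSignedPerm n) (words n n)

isNeg : ℤ → Bool
isNeg x = ⌊ x ℤP.<? + 0 ⌋

isEven : ℕ → Bool
isEven zero    = true
isEven (suc k) = not (isEven k)

neg : List ℤ → ℕ
neg w = length (filterᵇ isNeg w)

Dn : ℕ → List (List ℤ)
Dn n = filterᵇ (λ w → isEven (neg w)) (Bn n)

BDn : ℕ → List (List ℤ)
BDn n = filterᵇ (λ w → not (isEven (neg w))) (Bn n)

-- π_k for k ≥ 1 (1-based lookup in the window)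
at : List ℤ → ℕ → ℤ
at []       _             = + 0
at (x ∷ w)  zero          = + 0
at (x ∷ w)  (suc zero)    = x
at (x ∷ w)  (suc (suc k)) = at w (suc k)

-- value of π at an arbitrary nonzero integer: π(-i) = -π(i)
app : List ℤ → ℤ → ℤ
app w (+ k)      = at w k
app w -[1+ k ]   = - at w (suc k)

-- exc(π) = |{i ∈ [n] : π(|π(i)|) > π(i)}| + |{i ∈ [n] : π_i = -i}|
-- (exc_B = exc_D, the same statistic)
exc : List ℤ → ℕ
exc w = length (filterᵇ (λ p → ⌊ (let (i , x) = p in x) ℤP.<? app w (+ ∣ (let (i , x) = p in x) ∣) ⌋) iw)
      + length (filterᵇ (λ p → let (i , x) = p in ⌊ x ℤP.≟ - (+ i) ⌋) iw)
  where iw = zip (map suc (upTo (length w))) w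

nexc : ℕ → List ℤ → ℕ
nexc n w = n ∸ exc w

-- Formal polynomials in s, t with natural coefficients, represented by
-- their coefficient function:  P i j = coefficient of s^i t^j.

Poly : Set
Poly = ℕ → ℕ → ℕ

_⊕_ : Poly → Poly → Poly
(P ⊕ Q) i j = P i j + Q i j
infixl 6 _⊕_

sMul : Poly → Poly
sMul P zero    j = 0
sMul P (suc i) j = P i j

tMul : Poly → Poly
tMul P i zero    = 0
tMul P i (suc j) = P i j

∂s : Poly → Poly
∂s P i j = suc i * P (suc i) j

∂t : Poly → Poly
∂t P i j = suc j * P i (suc j)

Dop : Poly → Poly
Dop P = ∂s P ⊕ ∂t P

genExc : ℕ → List (List ℤ) → Poly
genExc n S i j = length (filterᵇ (λ w → ⌊ nexc n w ℕ.≟ i ⌋ ∧ ⌊ exc w ℕ.≟ j ⌋) S)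

BExc : ℕ → Poly
BExc n = genExc n (Bn n)

DExc : ℕ → Poly
DExc n = genExc n (Dn n)

BDExc : ℕ → Poly
BDExc n = genExc n (BDn n)

module Submission where

-- Every signed permutation of size m+1 arises in exactly one way from a
-- signed permutation π of size m by one of 2m+2 insertions of the letter
-- ±(m+1): either append ±(m+1), or choose i ∈ [m], put ±(m+1) at position
-- |π_i| and move the displaced letter π_{|π_i|} to the end.  Appending
-- +(m+1) keeps exc, appending -(m+1) raises it by one; the i-th middle
-- insertion keeps exc when i is an excedance of π and raises it by one
-- otherwise.  The sign of the inserted letter alone decides whether the
-- parity of the number of negative entries flips.  Hence, if e = exc π, the
-- two appends contribute s^{m+1-e}t^e and s^{m-e}t^{e+1} (one of each
-- parity) and the 2m middle insertions contribute, in each parity class,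
-- e·s^{m+1-e}t^e + (m-e)·s^{m-e}t^{e+1} = st·D(s^{m-e}t^e).
-- Summing over π ∈ 𝔅_m gives both recurrences.

open import Defs
open import Data.Nat using (ℕ; _≤_; _∸_)
open import Data.Product using (_×_)
open import Relation.Binary.PropositionalEquality using (_≡_)

open import Data.Bool using (Bool; true; false; _∧_; _∨_; not; if_then_else_)
open import Data.Bool.Properties using (∧-zeroʳ; ∧-assoc; ∧-comm; not-involutive)
open import Data.Bool.ListAction using (all; any)
open import Data.Empty using (⊥-elim)
open import Data.Integer as ℤ using (ℤ; -[1+_]; ∣_∣)
import Data.Integer.Properties as ℤP
open import Data.List using (List; []; _∷_; map; concatMap; concat; filterᵇ; length; upTo; zip; _++_; _∷ʳ_; applyUpTo)
import Data.List.Properties as LP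
open import Data.List.Relation.Unary.All as All using (All; []; _∷_)
open import Data.Nat as ℕ using (zero; suc; _+_; _*_; _<_; z≤n; s≤s; pred; ≢-nonZero)
open import Data.Nat.Properties
open import Algebra.Properties.CommutativeSemigroup +-commutativeSemigroup using (interchange; x∙yz≈y∙xz; xy∙z≈xz∙y; xy∙z≈zy∙x)
open import Data.Product using (_,_; proj₁; proj₂; ∃; ∃₂)
open import Data.Sum using (_⊎_; inj₁; inj₂)
open import Data.Unit using (⊤; tt)
open import Function using (_∘_)
open import Relation.Nullary using (¬_; Dec; yes; no)
open import Relation.Nullary.Decidable using (⌊_⌋)
open import Relation.Binary.PropositionalEquality

𝟙 : Bool → ℕ
𝟙 true  = 1
𝟙 false = 0

𝟙≤1 : ∀ b → 𝟙 b ≤ 1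
𝟙≤1 true  = s≤s z≤n
𝟙≤1 false = z≤n

𝟙-∧ : ∀ a b → 𝟙 (a ∧ b) ≡ 𝟙 a * 𝟙 b
𝟙-∧ true  true  = refl
𝟙-∧ true  false = refl
𝟙-∧ false b     = refl

𝟙-not : ∀ s → 𝟙 s + 𝟙 (not s) ≡ 1
𝟙-not true  = refl
𝟙-not false = refl

dec-true : {A : Set} (d : Dec A) → A → ⌊ d ⌋ ≡ true
dec-true (yes _) a = refl
dec-true (no ¬a) a = ⊥-elim (¬a a)

dec-false : {A : Set} (d : Dec A) → ¬ A → ⌊ d ⌋ ≡ false
dec-false (yes a) ¬a = ⊥-elim (¬a a)
dec-false (no _)  ¬a = refl

does-true⇒ : {A : Set} (d : Dec A) → ⌊ d ⌋ ≡ true → A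
does-true⇒ (yes a) _ = a
does-true⇒ (no _) ()

does-false⇒ : {A : Set} (d : Dec A) → ⌊ d ⌋ ≡ false → ¬ A
does-false⇒ (yes _) ()
does-false⇒ (no ¬a) _ = ¬a

∧-true⇒ : ∀ {a b} → a ∧ b ≡ true → a ≡ true × b ≡ true
∧-true⇒ {true} {true} _ = refl , refl

true-∧-true : ∀ {a b} → a ≡ true → b ≡ true → a ∧ b ≡ true
true-∧-true refl refl = refl

bool-ext : ∀ {a b} → (a ≡ true → b ≡ true) → (b ≡ true → a ≡ true) → a ≡ b
bool-ext {true}  {true}  _ _ = refl
bool-ext {true}  {false} f _ = sym (f refl)
bool-ext {false} {true}  _ g = g refl
bool-ext {false} {false} _ _ = refl

eqℕ : ℕ → ℕ → Bool
eqℕ a b = ⌊ a ℕ.≟ b ⌋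

eqℕ-refl : ∀ a → eqℕ a a ≡ true
eqℕ-refl a = dec-true (a ℕ.≟ a) refl

eqℕ-≢ : ∀ {a b} → a ≢ b → eqℕ a b ≡ false
eqℕ-≢ {a} {b} = dec-false (a ℕ.≟ b)

eqℕ-sym : ∀ a b → eqℕ a b ≡ eqℕ b a
eqℕ-sym a b = by-cases (a ℕ.≟ b)
  where
  by-cases : Dec (a ≡ b) → eqℕ a b ≡ eqℕ b a
  by-cases (yes refl) = refl
  by-cases (no a≢b)   = trans (eqℕ-≢ a≢b) (sym (eqℕ-≢ (a≢b ∘ sym)))

eqℕ-suc : ∀ a b → eqℕ (suc a) (suc b) ≡ eqℕ a b
eqℕ-suc a b = by-cases (a ℕ.≟ b)
  where
  by-cases : Dec (a ≡ b) → eqℕ (suc a) (suc b) ≡ eqℕ a b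
  by-cases (yes refl) = trans (eqℕ-refl (suc a)) (sym (eqℕ-refl a))
  by-cases (no a≢b)   = trans (eqℕ-≢ (a≢b ∘ suc-injective)) (sym (eqℕ-≢ a≢b))

eqℕ-suc-zero : ∀ a → eqℕ (suc a) 0 ≡ false
eqℕ-suc-zero a = eqℕ-≢ {suc a} {0} λ ()

count : {A : Set} → (A → Bool) → List A → ℕ
count p []       = 0
count p (x ∷ xs) = 𝟙 (p x) + count p xs

length-filter : {A : Set} (p : A → Bool) (xs : List A) → length (filterᵇ p xs) ≡ count p xs
length-filter p [] = refl
length-filter p (x ∷ xs) with p x
... | true  = cong suc (length-filter p xs)
... | false = length-filter p xs

count-cong : {A : Set} {p q : A → Bool} (xs : List A) → (∀ x → p x ≡ q x) → count p xs ≡ count q xs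
count-cong []       h = refl
count-cong (x ∷ xs) h = cong₂ _+_ (cong 𝟙 (h x)) (count-cong xs h)

count-++ : {A : Set} (p : A → Bool) (xs ys : List A) → count p (xs ++ ys) ≡ count p xs + count p ys
count-++ p []       ys = refl
count-++ p (x ∷ xs) ys = trans (cong (𝟙 (p x) +_) (count-++ p xs ys)) (sym (+-assoc (𝟙 (p x)) _ _))

count-snoc : {A : Set} (p : A → Bool) (xs : List A) (y : A) → count p (xs ∷ʳ y) ≡ count p xs + 𝟙 (p y)
count-snoc p xs y = trans (count-++ p xs (y ∷ [])) (cong (count p xs +_) (+-identityʳ _))

count-middle : {A : Set} (p : A → Bool) (xs : List A) (y : A) (zs : List A) →
               count p (xs ++ y ∷ zs) ≡ 𝟙 (p y) + count p (xs ++ zs)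
count-middle p []       y zs = refl
count-middle p (x ∷ xs) y zs = begin
    𝟙 (p x) + count p (xs ++ y ∷ zs)          ≡⟨ cong (𝟙 (p x) +_) (count-middle p xs y zs) ⟩
    𝟙 (p x) + (𝟙 (p y) + count p (xs ++ zs))  ≡⟨ x∙yz≈y∙xz (𝟙 (p x)) (𝟙 (p y)) _ ⟩
    𝟙 (p y) + (𝟙 (p x) + count p (xs ++ zs))  ∎
  where open ≡-Reasoning

count-filter : {A : Set} (p q : A → Bool) (xs : List A) → count p (filterᵇ q xs) ≡ count (λ x → q x ∧ p x) xs
count-filter p q [] = refl
count-filter p q (x ∷ xs) with q x
... | true  = cong (𝟙 (p x) +_) (count-filter p q xs)
... | false = count-filter p q xs

count-map : {A B : Set} (p : B → Bool) (f : A → B) (xs : List A) → count p (map f xs) ≡ count (p ∘ f) xs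
count-map p f []       = refl
count-map p f (x ∷ xs) = cong (𝟙 (p (f x)) +_) (count-map p f xs)

count-const-∧ : {A : Set} (b : Bool) (p : A → Bool) (xs : List A) → count (λ x → b ∧ p x) xs ≡ 𝟙 b * count p xs
count-const-∧ true  p xs       = sym (+-identityʳ _)
count-const-∧ false p []       = refl
count-const-∧ false p (x ∷ xs) = count-const-∧ false p xs

sumOver : {A : Set} → (A → ℕ) → List A → ℕ
sumOver f []       = 0
sumOver f (x ∷ xs) = f x + sumOver f xs

sumOver-cong : {A : Set} {f g : A → ℕ} (xs : List A) → (∀ a → f a ≡ g a) → sumOver f xs ≡ sumOver g xs
sumOver-cong []       h = refl
sumOver-cong (x ∷ xs) h = cong₂ _+_ (h x) (sumOver-cong xs h)

sumOver-congᴬˡˡ : {A : Set} {P : A → Set} {f g : A → ℕ} (xs : List A) → All P xs →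
                  (∀ a → P a → f a ≡ g a) → sumOver f xs ≡ sumOver g xs
sumOver-congᴬˡˡ []       []         h = refl
sumOver-congᴬˡˡ (x ∷ xs) (px ∷ pxs) h = cong₂ _+_ (h x px) (sumOver-congᴬˡˡ xs pxs h)

sumOver-zero : {A : Set} (xs : List A) → sumOver (λ _ → 0) xs ≡ 0
sumOver-zero []       = refl
sumOver-zero (x ∷ xs) = sumOver-zero xs

sumOver-+ : {A : Set} (f g : A → ℕ) (xs : List A) → sumOver (λ a → f a + g a) xs ≡ sumOver f xs + sumOver g xs
sumOver-+ f g []       = refl
sumOver-+ f g (x ∷ xs) =
  trans (cong (f x + g x +_) (sumOver-+ f g xs)) (interchange (f x) (g x) (sumOver f xs) (sumOver g xs))

sumOver-*ˡ : {A : Set} (c : ℕ) (f : A → ℕ) (xs : List A) → sumOver (λ a → c * f a) xs ≡ c * sumOver f xs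
sumOver-*ˡ c f []       = sym (*-zeroʳ c)
sumOver-*ˡ c f (x ∷ xs) = trans (cong (c * f x +_) (sumOver-*ˡ c f xs)) (sym (*-distribˡ-+ c (f x) (sumOver f xs)))

sumOver-*ʳ : {A : Set} (c : ℕ) (f : A → ℕ) (xs : List A) → sumOver (λ a → f a * c) xs ≡ sumOver f xs * c
sumOver-*ʳ c f []       = refl
sumOver-*ʳ c f (x ∷ xs) = trans (cong (f x * c +_) (sumOver-*ʳ c f xs)) (sym (*-distribʳ-+ c (f x) (sumOver f xs)))

count≡sumOver : {A : Set} (p : A → Bool) (xs : List A) → count p xs ≡ sumOver (𝟙 ∘ p) xs
count≡sumOver p []       = refl
count≡sumOver p (x ∷ xs) = cong (𝟙 (p x) +_) (count≡sumOver p xs)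

count-concatMap : {A B : Set} (p : B → Bool) (f : A → List B) (xs : List A) →
                  count p (concatMap f xs) ≡ sumOver (count p ∘ f) xs
count-concatMap p f []       = refl
count-concatMap p f (x ∷ xs) =
  trans (count-++ p (f x) (concat (map f xs))) (cong (count p (f x) +_) (count-concatMap p f xs))

sumBelow : ℕ → (ℕ → ℕ) → ℕ
sumBelow zero    f = 0
sumBelow (suc n) f = f 0 + sumBelow n (f ∘ suc)

sumOver-applyUpTo : (f : ℕ → ℕ) (F : ℕ → ℕ) (n : ℕ) → sumOver f (applyUpTo F n) ≡ sumBelow n (f ∘ F)
sumOver-applyUpTo f F zero    = refl
sumOver-applyUpTo f F (suc n) = cong (f (F 0) +_) (sumOver-applyUpTo f (F ∘ suc) n)

sumBelow-cong : ∀ n {f g : ℕ → ℕ} → (∀ j → j < n → f j ≡ g j) → sumBelow n f ≡ sumBelow n g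
sumBelow-cong zero    h = refl
sumBelow-cong (suc n) h = cong₂ _+_ (h 0 (s≤s z≤n)) (sumBelow-cong n (λ j j<n → h (suc j) (s≤s j<n)))

sumBelow-mono : ∀ n {f g : ℕ → ℕ} → (∀ j → j < n → f j ≤ g j) → sumBelow n f ≤ sumBelow n g
sumBelow-mono zero    h = z≤n
sumBelow-mono (suc n) h = +-mono-≤ (h 0 (s≤s z≤n)) (sumBelow-mono n (λ j j<n → h (suc j) (s≤s j<n)))

sumBelow-zero : ∀ n → sumBelow n (λ _ → 0) ≡ 0
sumBelow-zero zero    = refl
sumBelow-zero (suc n) = sumBelow-zero n

sumBelow-ones : ∀ n → sumBelow n (λ _ → 1) ≡ n
sumBelow-ones zero    = refl
sumBelow-ones (suc n) = cong suc (sumBelow-ones n)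

sumBelow-snoc : ∀ n f → sumBelow (suc n) f ≡ sumBelow n f + f n
sumBelow-snoc zero    f = +-comm (f 0) 0
sumBelow-snoc (suc n) f =
  trans (cong (f 0 +_) (sumBelow-snoc n (f ∘ suc))) (sym (+-assoc (f 0) _ _))

sumBelow-+ : ∀ n f g → sumBelow n (λ j → f j + g j) ≡ sumBelow n f + sumBelow n g
sumBelow-+ zero    f g = refl
sumBelow-+ (suc n) f g =
  trans (cong (f 0 + g 0 +_) (sumBelow-+ n (f ∘ suc) (g ∘ suc))) (interchange (f 0) (g 0) _ _)

sumBelow-*ʳ : ∀ n c f → sumBelow n (λ j → f j * c) ≡ sumBelow n f * c
sumBelow-*ʳ zero    c f = refl
sumBelow-*ʳ (suc n) c f =
  trans (cong (f 0 * c +_) (sumBelow-*ʳ n c (f ∘ suc))) (sym (*-distribʳ-+ c (f 0) _))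

sumBelow-point : ∀ n a → a < n → sumBelow n (λ j → 𝟙 (eqℕ j a)) ≡ 1
sumBelow-point (suc n) zero    _         = cong suc (trans (sumBelow-cong n λ j _ → cong 𝟙 (eqℕ-suc-zero j)) (sumBelow-zero n))
sumBelow-point (suc n) (suc a) (s≤s a<n) =
  trans (sumBelow-cong n λ j _ → cong 𝟙 (eqℕ-suc j a)) (sumBelow-point n a a<n)

sumBelow-point-outside : ∀ n a → n ≤ a → sumBelow n (λ j → 𝟙 (eqℕ j a)) ≡ 0
sumBelow-point-outside zero    a       _         = refl
sumBelow-point-outside (suc n) (suc a) (s≤s n≤a) =
  trans (sumBelow-cong n λ j _ → cong 𝟙 (eqℕ-suc j a)) (sumBelow-point-outside n a n≤a)

sumBelow-change₁ : ∀ n a {f g : ℕ → ℕ} → a < n → (∀ j → j < n → j ≢ a → f j ≡ g j) →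
                   sumBelow n f + g a ≡ sumBelow n g + f a
sumBelow-change₁ (suc n) zero {f} {g} _ h
  rewrite sumBelow-cong n {f ∘ suc} {g ∘ suc} (λ j j<n → h (suc j) (s≤s j<n) λ ())
  = xy∙z≈zy∙x (f 0) (sumBelow n (g ∘ suc)) (g 0)
sumBelow-change₁ (suc n) (suc a) {f} {g} (s≤s a<n) h
  rewrite h 0 (s≤s z≤n) (λ ())
  = trans (+-assoc (g 0) _ _)
      (trans (cong (g 0 +_) (sumBelow-change₁ n a a<n λ j j<n j≢a → h (suc j) (s≤s j<n) (j≢a ∘ suc-injective)))
        (sym (+-assoc (g 0) _ _)))

sumBelow-change₂ : ∀ n a b {f g : ℕ → ℕ} → a < n → b < n → a ≢ b →
                   (∀ j → j < n → j ≢ a → j ≢ b → f j ≡ g j) →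
                   sumBelow n f + g a + g b ≡ sumBelow n g + f a + f b
sumBelow-change₂ n a b {f} {g} a<n b<n a≢b h = begin
    sumBelow n f + g a + g b          ≡⟨ cong (λ z → sumBelow n f + z + g b) (sym mid-a) ⟩
    sumBelow n f + mid a + g b        ≡⟨ cong (_+ g b) (sumBelow-change₁ n a a<n f≈mid) ⟩
    sumBelow n mid + f a + g b        ≡⟨ xy∙z≈xz∙y (sumBelow n mid) (f a) (g b) ⟩
    sumBelow n mid + g b + f a        ≡⟨ cong (_+ f a) (sumBelow-change₁ n b b<n mid≈g) ⟩
    sumBelow n g + mid b + f a        ≡⟨ cong (λ z → sumBelow n g + z + f a) mid-b ⟩
    sumBelow n g + f b + f a          ≡⟨ xy∙z≈xz∙y (sumBelow n g) (f b) (f a) ⟩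
    sumBelow n g + f a + f b          ∎
  where
  open ≡-Reasoning
  mid : ℕ → ℕ
  mid j = if eqℕ j a then g j else f j
  mid-a : mid a ≡ g a
  mid-a = cong (λ c → if c then g a else f a) (eqℕ-refl a)
  mid-b : mid b ≡ f b
  mid-b = cong (λ c → if c then g b else f b) (eqℕ-≢ (a≢b ∘ sym))
  f≈mid : ∀ j → j < n → j ≢ a → f j ≡ mid j
  f≈mid j _ j≢a = cong (λ c → if c then g j else f j) (sym (eqℕ-≢ j≢a))
  mid≈g : ∀ j → j < n → j ≢ b → mid j ≡ g j
  mid≈g j j<n j≢b with eqℕ j a in e
  ... | true  = refl
  ... | false = h j j<n (does-false⇒ (j ℕ.≟ a) e) j≢b

sumBelow-≥-length : ∀ n f → (∀ j → j < n → 1 ≤ f j) → n ≤ sumBelow n f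
sumBelow-≥-length n f h = subst (_≤ sumBelow n f) (sumBelow-ones n) (sumBelow-mono n h)

sumBelow-≥-term : ∀ n f → (∀ j → j < n → 1 ≤ f j) → ∀ a → a < n → (n ∸ 1) + f a ≤ sumBelow n f
sumBelow-≥-term (suc n) f h zero _ =
  subst (_≤ f 0 + sumBelow n (f ∘ suc)) (+-comm (f 0) n)
        (+-monoʳ-≤ (f 0) (sumBelow-≥-length n (f ∘ suc) (λ j j<n → h (suc j) (s≤s j<n))))
sumBelow-≥-term (suc (suc n)) f h (suc a) (s≤s a<n) =
  +-mono-≤ (h 0 (s≤s z≤n)) (sumBelow-≥-term (suc n) (f ∘ suc) (λ j j<n → h (suc j) (s≤s j<n)) a a<n)

sumBelow-pigeonhole : ∀ n f → sumBelow n f ≡ n → (∀ j → j < n → 1 ≤ f j) → ∀ a → a < n → f a ≤ 1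
sumBelow-pigeonhole (suc n) f sum≡n h a a<n =
  +-cancelˡ-≤ n (f a) 1 (subst (n + f a ≤_) (trans sum≡n (+-comm 1 n)) (sumBelow-≥-term (suc n) f h a a<n))

sumBelow-complement : ∀ n (c : ℕ → ℕ) → (∀ j → j < n → c j ≤ 1) → sumBelow n (λ j → 1 ∸ c j) ≡ n ∸ sumBelow n c
sumBelow-complement n c h = begin
    sumBelow n (λ j → 1 ∸ c j)                             ≡⟨ sym (m+n∸n≡m _ (sumBelow n c)) ⟩
    sumBelow n (λ j → 1 ∸ c j) + sumBelow n c ∸ sumBelow n c ≡⟨ cong (_∸ sumBelow n c) (sym (sumBelow-+ n _ c)) ⟩
    sumBelow n (λ j → 1 ∸ c j + c j) ∸ sumBelow n c         ≡⟨ cong (_∸ sumBelow n c) ones ⟩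
    n ∸ sumBelow n c                                        ∎
  where
  open ≡-Reasoning
  ones : sumBelow n (λ j → 1 ∸ c j + c j) ≡ n
  ones = trans (sumBelow-cong n λ j j<n → m∸n+n≡m (h j j<n)) (sumBelow-ones n)

-- entry w j is the letter at 0-based position j, i.e. π_{j+1}.
entry : List ℤ → ℕ → ℤ
entry w j = at w (suc j)

update : List ℤ → ℕ → ℤ → List ℤ
update []      j       v = []
update (x ∷ w) zero    v = v ∷ w
update (x ∷ w) (suc j) v = x ∷ update w j v

length-update : ∀ w j v → length (update w j v) ≡ length w
length-update []      j       v = refl
length-update (x ∷ w) zero    v = refl
length-update (x ∷ w) (suc j) v = cong suc (length-update w j v)

entry-update-same : ∀ w j v → j < length w → entry (update w j v) j ≡ v
entry-update-same (x ∷ w) zero    v _         = refl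
entry-update-same (x ∷ w) (suc j) v (s≤s j<w) = entry-update-same w j v j<w

entry-update-other : ∀ w j v i → i ≢ j → entry (update w j v) i ≡ entry w i
entry-update-other []      j       v i       i≢j = refl
entry-update-other (x ∷ w) zero    v zero    i≢j = ⊥-elim (i≢j refl)
entry-update-other (x ∷ w) zero    v (suc i) i≢j = refl
entry-update-other (x ∷ w) (suc j) v zero    i≢j = refl
entry-update-other (x ∷ w) (suc j) v (suc i) i≢j = entry-update-other w j v i (i≢j ∘ cong suc)

update-update : ∀ w j a b → update (update w j a) j b ≡ update w j b
update-update []      j       a b = refl
update-update (x ∷ w) zero    a b = refl
update-update (x ∷ w) (suc j) a b = cong (x ∷_) (update-update w j a b)

update-entry : ∀ w j → update w j (entry w j) ≡ w
update-entry []      j       = refl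
update-entry (x ∷ w) zero    = refl
update-entry (x ∷ w) (suc j) = cong (x ∷_) (update-entry w j)

length-snoc : ∀ w (y : ℤ) → length (w ∷ʳ y) ≡ suc (length w)
length-snoc w y = trans (LP.length-++ w) (+-comm (length w) 1)

entry-++ˡ : ∀ w ys j → j < length w → entry (w ++ ys) j ≡ entry w j
entry-++ˡ (x ∷ w) ys zero    _         = refl
entry-++ˡ (x ∷ w) ys (suc j) (s≤s j<w) = entry-++ˡ w ys j j<w

entry-snoc-last : ∀ w y → entry (w ∷ʳ y) (length w) ≡ y
entry-snoc-last []      y = refl
entry-snoc-last (x ∷ w) y = entry-snoc-last w y

entry-snoc-cases : ∀ w y j → j < suc (length w) →
                   (j < length w × entry (w ∷ʳ y) j ≡ entry w j) ⊎ (entry (w ∷ʳ y) j ≡ y)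
entry-snoc-cases w y j j≤w with j ℕ.<? length w
... | yes j<w = inj₁ (j<w , entry-++ˡ w (y ∷ []) j j<w)
... | no  j≮w = inj₂ (trans (cong (entry (w ∷ʳ y)) j≡w) (entry-snoc-last w y))
  where
  j≡w : j ≡ length w
  j≡w = ≤-antisym (≤-pred j≤w) (≮⇒≥ j≮w)

snoc-view : ∀ m (w : List ℤ) → length w ≡ suc m → ∃₂ λ ws y → w ≡ ws ∷ʳ y × length ws ≡ m
snoc-view zero    (y ∷ []) _ = [] , y , refl , refl
snoc-view (suc m) (x ∷ w)  e with snoc-view m w (suc-injective e)
... | ws , y , refl , len = x ∷ ws , y , refl , cong suc len

entry-ext : ∀ w v → length w ≡ length v → (∀ j → j < length w → entry w j ≡ entry v j) → w ≡ v
entry-ext []      []      _ _ = refl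
entry-ext (x ∷ w) (y ∷ v) e h =
  cong₂ _∷_ (h 0 (s≤s z≤n)) (entry-ext w v (suc-injective e) (λ j j<w → h (suc j) (s≤s j<w)))

count-≥-entry : (p : ℤ → Bool) (w : List ℤ) (j : ℕ) → j < length w → 𝟙 (p (entry w j)) ≤ count p w
count-≥-entry p (x ∷ w) zero    _         = m≤m+n _ _
count-≥-entry p (x ∷ w) (suc j) (s≤s j<w) = ≤-trans (count-≥-entry p w j j<w) (m≤n+m _ _)

count-≥-two-entries : (p : ℤ → Bool) (w : List ℤ) (i j : ℕ) → i < length w → j < length w → i ≢ j →
                      𝟙 (p (entry w i)) + 𝟙 (p (entry w j)) ≤ count p w
count-≥-two-entries p (x ∷ w) zero    zero    _         _         i≢j = ⊥-elim (i≢j refl)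
count-≥-two-entries p (x ∷ w) zero    (suc j) _         (s≤s j<w) _   = +-monoʳ-≤ (𝟙 (p x)) (count-≥-entry p w j j<w)
count-≥-two-entries p (x ∷ w) (suc i) zero    (s≤s i<w) _         _   =
  subst (_≤ 𝟙 (p x) + count p w) (+-comm (𝟙 (p x)) _) (+-monoʳ-≤ (𝟙 (p x)) (count-≥-entry p w i i<w))
count-≥-two-entries p (x ∷ w) (suc i) (suc j) (s≤s i<w) (s≤s j<w) i≢j =
  ≤-trans (count-≥-two-entries p w i j i<w j<w (i≢j ∘ cong suc)) (m≤n+m _ _)

count-update : (p : ℤ → Bool) (w : List ℤ) (k : ℕ) (v : ℤ) → k < length w →
               count p (update w k v) + 𝟙 (p (entry w k)) ≡ count p w + 𝟙 (p v)
count-update p (x ∷ w) zero    v _         = trans (+-assoc (𝟙 (p v)) _ _)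
  (trans (+-comm (𝟙 (p v)) _) (cong (_+ 𝟙 (p v)) (+-comm (count p w) (𝟙 (p x)))))
count-update p (x ∷ w) (suc k) v (s≤s k<w) = trans (+-assoc (𝟙 (p x)) _ _)
  (trans (cong (𝟙 (p x) +_) (count-update p w k v k<w)) (sym (+-assoc (𝟙 (p x)) _ _)))

climb : List ℤ → ℕ → Bool
climb W j = ⌊ entry W j ℤP.<? app W (ℤ.+ ∣ entry W j ∣) ⌋

negFixed : List ℤ → ℕ → Bool
negFixed W j = ⌊ entry W j ℤP.≟ ℤ.- (ℤ.+ suc j) ⌋

excAt : List ℤ → ℕ → ℕ
excAt W j = 𝟙 (climb W j) + 𝟙 (negFixed W j)

count-zip : (p : ℕ × ℤ → Bool) (F : ℕ → ℕ) (v : List ℤ) →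
            count p (zip (applyUpTo F (length v)) v) ≡ sumBelow (length v) (λ j → 𝟙 (p (F j , entry v j)))
count-zip p F []      = refl
count-zip p F (x ∷ v) = cong (𝟙 (p (F 0 , x)) +_) (count-zip p (F ∘ suc) v)

exc≡sumBelow : ∀ W n → length W ≡ n → exc W ≡ sumBelow n (excAt W)
exc≡sumBelow W n refl = begin
    exc W                                           ≡⟨ cong₂ _+_ (length-filter climbᵖ iw) (length-filter negFixedᵖ iw) ⟩
    count climbᵖ iw + count negFixedᵖ iw              ≡⟨ cong₂ (λ a b → count climbᵖ a + count negFixedᵖ b) iw≡ iw≡ ⟩
    count climbᵖ iw′ + count negFixedᵖ iw′            ≡⟨ cong₂ _+_ (count-zip climbᵖ suc W) (count-zip negFixedᵖ suc W) ⟩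
    sumBelow (length W) (𝟙 ∘ climb W) + sumBelow (length W) (𝟙 ∘ negFixed W) ≡⟨ sym (sumBelow-+ (length W) _ _) ⟩
    sumBelow (length W) (excAt W)                   ∎
  where
  open ≡-Reasoning
  climbᵖ negFixedᵖ : ℕ × ℤ → Bool
  climbᵖ (_ , x)    = ⌊ x ℤP.<? app W (ℤ.+ ∣ x ∣) ⌋
  negFixedᵖ (i , x) = ⌊ x ℤP.≟ ℤ.- (ℤ.+ i) ⌋
  iw iw′ : List (ℕ × ℤ)
  iw  = zip (map suc (upTo (length W))) W
  iw′ = zip (applyUpTo suc (length W)) W
  iw≡ : iw ≡ iw′
  iw≡ = cong (λ l → zip l W) (LP.map-applyUpTo (λ x → x) suc (length W))

InRange : ℕ → ℤ → Set
InRange N x = 1 ≤ ∣ x ∣ × ∣ x ∣ ≤ N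

record IsSignedPerm (N : ℕ) (w : List ℤ) : Set where
  constructor signedPerm
  field
    length≡ : length w ≡ N
    inRange : ∀ j → j < N → InRange N (entry w j)
    covers  : ∀ v → v < N → ∃ λ j → j < N × ∣ entry w j ∣ ≡ suc v

open IsSignedPerm

InRange-suc : ∀ m x → InRange m x → InRange (suc m) x
InRange-suc m x (1≤x , x≤m) = 1≤x , m≤n⇒m≤1+n x≤m

InRange-pred : ∀ m x → InRange (suc m) x → ∣ x ∣ ≢ suc m → InRange m x
InRange-pred m x (1≤x , x≤1+m) x≢1+m = 1≤x , ≤-pred (≤∧≢⇒< x≤1+m x≢1+m)

abs-suc-pred : ∀ x → 1 ≤ ∣ x ∣ → ∣ x ∣ ≡ suc (pred ∣ x ∣)
abs-suc-pred x 1≤x = sym (suc-pred ∣ x ∣ ⦃ ≢-nonZero (λ x≡0 → <⇒≢ 1≤x (sym x≡0)) ⦄)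

occurrences : ℕ → List ℤ → ℕ
occurrences v = count (λ x → eqℕ ∣ x ∣ (suc v))

sumBelow-occurrences : ∀ N w → (∀ j → j < length w → InRange N (entry w j)) →
                       sumBelow N (λ v → occurrences v w) ≡ length w
sumBelow-occurrences N []      h = sumBelow-zero N
sumBelow-occurrences N (x ∷ w) h = begin
    sumBelow N (λ v → 𝟙 (eqℕ ∣ x ∣ (suc v)) + occurrences v w)               ≡⟨ sumBelow-+ N _ _ ⟩
    sumBelow N (λ v → 𝟙 (eqℕ ∣ x ∣ (suc v))) + sumBelow N (λ v → occurrences v w)
      ≡⟨ cong₂ _+_ occurs-once (sumBelow-occurrences N w (λ j j<w → h (suc j) (s≤s j<w))) ⟩
    suc (length w)                                                          ∎
  where
  open ≡-Reasoning
  x∈ : InRange N x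
  x∈ = h 0 (s≤s z≤n)
  a = pred ∣ x ∣
  x≡1+a : ∣ x ∣ ≡ suc a
  x≡1+a = abs-suc-pred x (proj₁ x∈)
  occurs-once : sumBelow N (λ v → 𝟙 (eqℕ ∣ x ∣ (suc v))) ≡ 1
  occurs-once = trans (sumBelow-cong N λ v _ → cong 𝟙 (trans (cong (λ z → eqℕ z (suc v)) x≡1+a)
                                                       (trans (eqℕ-suc a v) (eqℕ-sym a v))))
                      (sumBelow-point N a (subst (_≤ N) x≡1+a (proj₂ x∈)))

-- In a signed permutation distinct positions carry distinct absolute values:
-- otherwise some value would occur twice, and by pigeonhole another one
-- would be missing.
abs-injective : ∀ {N w} → IsSignedPerm N w → ∀ i j → i < N → j < N → ∣ entry w i ∣ ≡ ∣ entry w j ∣ → i ≡ j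
abs-injective {N} {w} sp i j i<N j<N |wi|≡|wj| with i ℕ.≟ j
... | yes i≡j = i≡j
... | no  i≢j = ⊥-elim (<⇒≱ (s≤s (s≤s z≤n)) (≤-trans twice at-most-once))
  where
  to-length : ∀ {j} → j < N → j < length w
  to-length = subst (_ <_) (sym (length≡ sp))
  a = pred ∣ entry w i ∣
  |wi|≡1+a : ∣ entry w i ∣ ≡ suc a
  |wi|≡1+a = abs-suc-pred (entry w i) (proj₁ (inRange sp i i<N))
  is-a : ℤ → Bool
  is-a x = eqℕ ∣ x ∣ (suc a)
  twice : 2 ≤ occurrences a w
  twice = subst₂ (λ p q → 𝟙 p + 𝟙 q ≤ occurrences a w)
                 (dec-true (∣ entry w i ∣ ℕ.≟ suc a) |wi|≡1+a)
                 (dec-true (∣ entry w j ∣ ℕ.≟ suc a) (trans (sym |wi|≡|wj|) |wi|≡1+a))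
                 (count-≥-two-entries is-a w i j (to-length i<N) (to-length j<N) i≢j)
  occurs : ∀ v → v < N → 1 ≤ occurrences v w
  occurs v v<N with covers sp v v<N
  ... | k , k<N , |wk|≡1+v = subst (λ p → 𝟙 p ≤ occurrences v w) (dec-true (∣ entry w k ∣ ℕ.≟ suc v) |wk|≡1+v)
                               (count-≥-entry (λ x → eqℕ ∣ x ∣ (suc v)) w k (to-length k<N))
  total : sumBelow N (λ v → occurrences v w) ≡ N
  total = trans (sumBelow-occurrences N w (λ j j<w → inRange sp j (subst (j <_) (length≡ sp) j<w))) (length≡ sp)
  at-most-once : occurrences a w ≤ 1
  at-most-once = sumBelow-pigeonhole N _ total occurs a (subst (_≤ N) |wi|≡1+a (proj₂ (inRange sp i i<N)))

eqL : List ℤ → List ℤ → Bool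
eqL w v = ⌊ LP.≡-dec ℤP._≟_ w v ⌋

eqZ : ℤ → ℤ → Bool
eqZ x y = ⌊ x ℤP.≟ y ⌋

mult : List ℤ → List (List ℤ) → ℕ
mult w = count (eqL w)

eqL-true⇒ : ∀ {w v} → eqL w v ≡ true → w ≡ v
eqL-true⇒ {w} {v} = does-true⇒ (LP.≡-dec ℤP._≟_ w v)

eqL-refl : ∀ w → eqL w w ≡ true
eqL-refl w = dec-true (LP.≡-dec ℤP._≟_ w w) refl

eqL-cons : ∀ x y w v → eqL (x ∷ w) (y ∷ v) ≡ eqZ x y ∧ eqL w v
eqL-cons x y w v = by-cases (x ℤP.≟ y) (LP.≡-dec ℤP._≟_ w v)
  where
  both = LP.≡-dec ℤP._≟_ (x ∷ w) (y ∷ v)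
  by-cases : Dec (x ≡ y) → Dec (w ≡ v) → eqL (x ∷ w) (y ∷ v) ≡ eqZ x y ∧ eqL w v
  by-cases (yes refl) (yes refl) = trans (eqL-refl (x ∷ w)) (sym (cong₂ _∧_ (dec-true (x ℤP.≟ x) refl) (eqL-refl w)))
  by-cases (yes refl) (no w≢v)   = trans (dec-false both (w≢v ∘ proj₂ ∘ LP.∷-injective))
                                         (sym (cong₂ _∧_ (dec-true (x ℤP.≟ x) refl) (dec-false (LP.≡-dec ℤP._≟_ w v) w≢v)))
  by-cases (no x≢y)   _          = trans (dec-false both (x≢y ∘ proj₁ ∘ LP.∷-injective))
                                         (sym (cong (_∧ eqL w v) (dec-false (x ℤP.≟ y) x≢y)))

mult-filter : ∀ w (q : List ℤ → Bool) L → mult w (filterᵇ q L) ≡ 𝟙 (q w) * mult w L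
mult-filter w q L = begin
    count (eqL w) (filterᵇ q L)          ≡⟨ count-filter (eqL w) q L ⟩
    count (λ v → q v ∧ eqL w v) L        ≡⟨ count-cong L q-at-w ⟩
    count (λ v → q w ∧ eqL w v) L        ≡⟨ count-const-∧ (q w) (eqL w) L ⟩
    𝟙 (q w) * mult w L                   ∎
  where
  open ≡-Reasoning
  q-at-w : ∀ v → (q v ∧ eqL w v) ≡ (q w ∧ eqL w v)
  q-at-w v with eqL w v in e
  ... | true  = cong (_∧ true) (cong q (sym (eqL-true⇒ e)))
  ... | false = trans (∧-zeroʳ (q v)) (sym (∧-zeroʳ (q w)))

inRangeᵇ : ℕ → ℤ → Bool
inRangeᵇ N x = ⌊ 1 ℕ.≤? ∣ x ∣ ⌋ ∧ ⌊ ∣ x ∣ ℕ.≤? N ⌋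

inRangeᵇ⇒ : ∀ N x → inRangeᵇ N x ≡ true → InRange N x
inRangeᵇ⇒ N x e with ∧-true⇒ {⌊ 1 ℕ.≤? ∣ x ∣ ⌋} e
... | e₁ , e₂ = does-true⇒ (1 ℕ.≤? ∣ x ∣) e₁ , does-true⇒ (∣ x ∣ ℕ.≤? N) e₂

⇒inRangeᵇ : ∀ N x → InRange N x → inRangeᵇ N x ≡ true
⇒inRangeᵇ N x (1≤x , x≤N) = true-∧-true (dec-true (1 ℕ.≤? ∣ x ∣) 1≤x) (dec-true (∣ x ∣ ℕ.≤? N) x≤N)

eqZ-pos : ∀ a i → eqZ (ℤ.+ suc a) (ℤ.+ suc i) ≡ eqℕ i a
eqZ-pos a i = by-cases (a ℕ.≟ i)
  where
  by-cases : Dec (a ≡ i) → eqZ (ℤ.+ suc a) (ℤ.+ suc i) ≡ eqℕ i a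
  by-cases (yes refl) = trans (dec-true (ℤ.+ suc a ℤP.≟ ℤ.+ suc a) refl) (sym (eqℕ-refl a))
  by-cases (no a≢i)   = trans (dec-false (ℤ.+ suc a ℤP.≟ ℤ.+ suc i) (a≢i ∘ suc-injective ∘ ℤP.+-injective))
                              (sym (eqℕ-≢ (a≢i ∘ sym)))

eqZ-neg : ∀ a i → eqZ -[1+ a ] -[1+ i ] ≡ eqℕ i a
eqZ-neg a i = by-cases (a ℕ.≟ i)
  where
  by-cases : Dec (a ≡ i) → eqZ -[1+ a ] -[1+ i ] ≡ eqℕ i a
  by-cases (yes refl) = trans (dec-true (-[1+ a ] ℤP.≟ -[1+ a ]) refl) (sym (eqℕ-refl a))
  by-cases (no a≢i)   = trans (dec-false (-[1+ a ] ℤP.≟ -[1+ i ]) (a≢i ∘ ℤP.-[1+-injective)) (sym (eqℕ-≢ (a≢i ∘ sym)))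

count-vals : ∀ n x → count (eqZ x) (vals n) ≡ 𝟙 (inRangeᵇ n x)
count-vals n x = begin
    count (eqZ x) (vals n)
      ≡⟨ count-concatMap (eqZ x) (λ i → ℤ.+ (suc i) ∷ -[1+ i ] ∷ []) (upTo n) ⟩
    sumOver (λ i → 𝟙 (eqZ x (ℤ.+ suc i)) + (𝟙 (eqZ x -[1+ i ]) + 0)) (upTo n)
      ≡⟨ sumOver-applyUpTo _ (λ i → i) n ⟩
    sumBelow n (λ i → 𝟙 (eqZ x (ℤ.+ suc i)) + (𝟙 (eqZ x -[1+ i ]) + 0))
      ≡⟨ by-letter x ⟩
    𝟙 (inRangeᵇ n x) ∎
  where
  open ≡-Reasoning
  point : ∀ a → sumBelow n (λ i → 𝟙 (eqℕ i a)) ≡ 𝟙 (inRangeᵇ n (ℤ.+ suc a))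
  point a with suc a ℕ.≤? n
  ... | yes a<n = sumBelow-point n a a<n
  ... | no  a≮n = sumBelow-point-outside n a (≮⇒≥ a≮n)
  by-letter : ∀ x → sumBelow n (λ i → 𝟙 (eqZ x (ℤ.+ suc i)) + (𝟙 (eqZ x -[1+ i ]) + 0)) ≡ 𝟙 (inRangeᵇ n x)
  by-letter (ℤ.+ zero)  = sumBelow-zero n
  by-letter (ℤ.+ suc a) = trans (sumBelow-cong n λ i _ → trans (+-identityʳ _) (cong 𝟙 (eqZ-pos a i))) (point a)
  by-letter -[1+ a ]    = trans (sumBelow-cong n λ i _ → trans (+-identityʳ _) (cong 𝟙 (eqZ-neg a i))) (point a)

mult-map-cons : ∀ x w v V → mult (x ∷ w) (map (_∷ v) V) ≡ 𝟙 (eqL w v) * count (eqZ x) V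
mult-map-cons x w v []      = sym (*-zeroʳ (𝟙 (eqL w v)))
mult-map-cons x w v (y ∷ V) = begin
    𝟙 (eqL (x ∷ w) (y ∷ v)) + mult (x ∷ w) (map (_∷ v) V)
      ≡⟨ cong₂ _+_ (trans (cong 𝟙 (eqL-cons x y w v)) (trans (𝟙-∧ (eqZ x y) (eqL w v)) (*-comm (𝟙 (eqZ x y)) _)))
                   (mult-map-cons x w v V) ⟩
    𝟙 (eqL w v) * 𝟙 (eqZ x y) + 𝟙 (eqL w v) * count (eqZ x) V
      ≡⟨ sym (*-distribˡ-+ (𝟙 (eqL w v)) _ _) ⟩
    𝟙 (eqL w v) * count (eqZ x) (y ∷ V) ∎
  where open ≡-Reasoning

mult-map-nil : ∀ v V → mult [] (map (_∷ v) V) ≡ 0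
mult-map-nil v []      = refl
mult-map-nil v (y ∷ V) = mult-map-nil v V

mult-words : ∀ k n w → mult w (words k n) ≡ 𝟙 (eqℕ (length w) k ∧ all (inRangeᵇ n) w)
mult-words zero    n []      = refl
mult-words zero    n (x ∷ w) = refl
mult-words (suc k) n []      =
  trans (count-concatMap (eqL []) (λ v → map (_∷ v) (vals n)) (words k n))
        (trans (sumOver-cong (words k n) (λ v → mult-map-nil v (vals n))) (sumOver-zero (words k n)))
mult-words (suc k) n (x ∷ w) = begin
    mult (x ∷ w) (words (suc k) n)
      ≡⟨ count-concatMap (eqL (x ∷ w)) (λ v → map (_∷ v) (vals n)) (words k n) ⟩
    sumOver (λ v → mult (x ∷ w) (map (_∷ v) (vals n))) (words k n)
      ≡⟨ sumOver-cong (words k n) (λ v → mult-map-cons x w v (vals n)) ⟩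
    sumOver (λ v → 𝟙 (eqL w v) * count (eqZ x) (vals n)) (words k n)
      ≡⟨ sumOver-*ʳ _ (𝟙 ∘ eqL w) (words k n) ⟩
    sumOver (𝟙 ∘ eqL w) (words k n) * count (eqZ x) (vals n)
      ≡⟨ cong₂ _*_ (trans (sym (count≡sumOver (eqL w) (words k n))) (mult-words k n w)) (count-vals n x) ⟩
    𝟙 (ok-w) * 𝟙 (inRangeᵇ n x)
      ≡⟨ sym (𝟙-∧ ok-w (inRangeᵇ n x)) ⟩
    𝟙 (ok-w ∧ inRangeᵇ n x)
      ≡⟨ cong 𝟙 (trans (∧-assoc (eqℕ (length w) k) _ _) (cong (eqℕ (length w) k ∧_) (∧-comm (all (inRangeᵇ n) w) _))) ⟩
    𝟙 (eqℕ (length w) k ∧ (inRangeᵇ n x ∧ all (inRangeᵇ n) w))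
      ≡⟨ cong (λ z → 𝟙 (z ∧ (inRangeᵇ n x ∧ all (inRangeᵇ n) w))) (sym (eqℕ-suc (length w) k)) ⟩
    𝟙 (eqℕ (suc (length w)) (suc k) ∧ (inRangeᵇ n x ∧ all (inRangeᵇ n) w)) ∎
  where
  open ≡-Reasoning
  ok-w = eqℕ (length w) k ∧ all (inRangeᵇ n) w

isSignedPermᵇ : ℕ → List ℤ → Bool
isSignedPermᵇ N w = isSignedPerm N w ∧ (eqℕ (length w) N ∧ all (inRangeᵇ N) w)

mult-Bn : ∀ N w → mult w (Bn N) ≡ 𝟙 (isSignedPermᵇ N w)
mult-Bn N w = begin
    mult w (Bn N)                                                        ≡⟨ mult-filter w (isSignedPerm N) (words N N) ⟩
    𝟙 (isSignedPerm N w) * mult w (words N N)                             ≡⟨ cong (𝟙 (isSignedPerm N w) *_) (mult-words N N w) ⟩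
    𝟙 (isSignedPerm N w) * 𝟙 (eqℕ (length w) N ∧ all (inRangeᵇ N) w)     ≡⟨ sym (𝟙-∧ (isSignedPerm N w) _) ⟩
    𝟙 (isSignedPermᵇ N w)                                                ∎
  where open ≡-Reasoning

all-upTo⇒ : ∀ (f : ℕ → Bool) F n → all f (applyUpTo F n) ≡ true → ∀ i → i < n → f (F i) ≡ true
all-upTo⇒ f F (suc n) e zero    _         = proj₁ (∧-true⇒ e)
all-upTo⇒ f F (suc n) e (suc i) (s≤s i<n) = all-upTo⇒ f (F ∘ suc) n (proj₂ (∧-true⇒ {f (F 0)} e)) i i<n

⇒all-upTo : ∀ (f : ℕ → Bool) F n → (∀ i → i < n → f (F i) ≡ true) → all f (applyUpTo F n) ≡ true
⇒all-upTo f F zero    h = refl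
⇒all-upTo f F (suc n) h = true-∧-true (h 0 (s≤s z≤n)) (⇒all-upTo f (F ∘ suc) n (λ i i<n → h (suc i) (s≤s i<n)))

all-entries⇒ : ∀ (g : ℤ → Bool) w → all g w ≡ true → ∀ j → j < length w → g (entry w j) ≡ true
all-entries⇒ g (x ∷ w) e zero    _         = proj₁ (∧-true⇒ e)
all-entries⇒ g (x ∷ w) e (suc j) (s≤s j<w) = all-entries⇒ g w (proj₂ (∧-true⇒ {g x} e)) j j<w

⇒all-entries : ∀ (g : ℤ → Bool) w → (∀ j → j < length w → g (entry w j) ≡ true) → all g w ≡ true
⇒all-entries g []      h = refl
⇒all-entries g (x ∷ w) h = true-∧-true (h 0 (s≤s z≤n)) (⇒all-entries g w (λ j j<w → h (suc j) (s≤s j<w)))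

any-entry⇒ : ∀ (g : ℤ → Bool) w → any g w ≡ true → ∃ λ j → j < length w × g (entry w j) ≡ true
any-entry⇒ g (x ∷ w) e with g x in gx
... | true  = 0 , s≤s z≤n , gx
... | false with any-entry⇒ g w e
...   | j , j<w , gj = suc j , s≤s j<w , gj

⇒any-entry : ∀ (g : ℤ → Bool) w j → j < length w → g (entry w j) ≡ true → any g w ≡ true
⇒any-entry g (x ∷ w) zero    _         gx rewrite gx = refl
⇒any-entry g (x ∷ w) (suc j) (s≤s j<w) gj rewrite ⇒any-entry g w j j<w gj = ∨-true (g x)
  where
  ∨-true : ∀ b → (b ∨ true) ≡ true
  ∨-true true  = refl
  ∨-true false = refl

isSignedPermᵇ⇒ : ∀ N w → isSignedPermᵇ N w ≡ true → IsSignedPerm N w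
isSignedPermᵇ⇒ N w e with ∧-true⇒ {isSignedPerm N w} e
... | covered , rest with ∧-true⇒ {eqℕ (length w) N} rest
... | len , ranged = signedPerm len≡N in-range covering
  where
  len≡N : length w ≡ N
  len≡N = does-true⇒ (length w ℕ.≟ N) len
  in-range : ∀ j → j < N → InRange N (entry w j)
  in-range j j<N = inRangeᵇ⇒ N (entry w j) (all-entries⇒ (inRangeᵇ N) w ranged j (subst (j <_) (sym len≡N) j<N))
  covering : ∀ v → v < N → ∃ λ j → j < N × ∣ entry w j ∣ ≡ suc v
  covering v v<N with any-entry⇒ (λ x → ⌊ ∣ x ∣ ℕ.≟ suc v ⌋) w
                        (all-upTo⇒ (λ i → any (λ x → ⌊ ∣ x ∣ ℕ.≟ suc i ⌋) w) (λ i → i) N covered v v<N)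
  ... | j , j<w , hit = j , subst (j <_) len≡N j<w , does-true⇒ (∣ entry w j ∣ ℕ.≟ suc v) hit

⇒isSignedPermᵇ : ∀ N w → IsSignedPerm N w → isSignedPermᵇ N w ≡ true
⇒isSignedPermᵇ N w (signedPerm len≡N in-range covering) =
  true-∧-true covered (true-∧-true (dec-true (length w ℕ.≟ N) len≡N) ranged)
  where
  to-length : ∀ {j} → j < N → j < length w
  to-length = subst (_ <_) (sym len≡N)
  ranged : all (inRangeᵇ N) w ≡ true
  ranged = ⇒all-entries (inRangeᵇ N) w λ j j<w → ⇒inRangeᵇ N (entry w j) (in-range j (subst (j <_) len≡N j<w))
  covered : isSignedPerm N w ≡ true
  covered = ⇒all-upTo _ (λ i → i) N λ v v<N →
    let (j , j<N , hit) = covering v v<N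
    in ⇒any-entry (λ x → ⌊ ∣ x ∣ ℕ.≟ suc v ⌋) w j (to-length j<N) (dec-true (∣ entry w j ∣ ℕ.≟ suc v) hit)

mult-member : ∀ (L : List (List ℤ)) → All (λ v → 1 ≤ mult v L) L
mult-member []      = []
mult-member (x ∷ L) =
  subst (λ b → 1 ≤ 𝟙 b + mult x L) (sym (eqL-refl x)) (s≤s z≤n) ∷ All.map (λ h → ≤-trans h (m≤n+m _ _)) (mult-member L)

Bn-signedPerms : ∀ N → All (IsSignedPerm N) (Bn N)
Bn-signedPerms N = All.map (λ {v} h → isSignedPermᵇ⇒ N v (positive (subst (1 ≤_) (mult-Bn N v) h))) (mult-member (Bn N))
  where
  positive : ∀ {b} → 1 ≤ 𝟙 b → b ≡ true
  positive {true} _ = refl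

split-at-member : ∀ x (ys : List (List ℤ)) → 1 ≤ mult x ys → ∃₂ λ ys₁ ys₂ → ys ≡ ys₁ ++ x ∷ ys₂
split-at-member x (y ∷ ys) h with eqL x y in e
... | true  = [] , ys , cong (_∷ ys) (sym (eqL-true⇒ e))
... | false with split-at-member x ys h
...   | ys₁ , ys₂ , refl = y ∷ ys₁ , ys₂ , refl

count-from-mult : ∀ (xs ys : List (List ℤ)) → (∀ w → mult w xs ≡ mult w ys) → ∀ p → count p xs ≡ count p ys
count-from-mult []       []       h p = refl
count-from-mult []       (y ∷ ys) h p with h y
... | e rewrite eqL-refl y = ⊥-elim (0≢1+n e)
count-from-mult (x ∷ xs) ys       h p
  with split-at-member x ys (subst (1 ≤_) (h x) (All.head (mult-member (x ∷ xs))))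
... | ys₁ , ys₂ , refl =
  trans (cong (𝟙 (p x) +_) (count-from-mult xs (ys₁ ++ ys₂) rest p)) (sym (count-middle p ys₁ x ys₂))
  where
  rest : ∀ w → mult w xs ≡ mult w (ys₁ ++ ys₂)
  rest w = +-cancelˡ-≡ (𝟙 (eqL w x)) _ _ (trans (h w) (count-middle (eqL w) ys₁ x ys₂))

-- Inserting the top letter ±(m+1) into a signed permutation of size m

topLetter : Bool → ℕ → ℤ
topLetter true  m = ℤ.+ suc m
topLetter false m = -[1+ m ]

abs-topLetter : ∀ s m → ∣ topLetter s m ∣ ≡ suc m
abs-topLetter true  m = refl
abs-topLetter false m = refl

InRange-topLetter : ∀ s m → InRange (suc m) (topLetter s m)
InRange-topLetter true  m = s≤s z≤n , ≤-refl
InRange-topLetter false m = s≤s z≤n , ≤-refl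

topLetter-injective : ∀ {s s′} m → topLetter s m ≡ topLetter s′ m → s ≡ s′
topLetter-injective {true}  {true}  m _ = refl
topLetter-injective {false} {false} m _ = refl
topLetter-injective {true}  {false} m ()
topLetter-injective {false} {true}  m ()

abs≡⇒topLetter : ∀ x m → ∣ x ∣ ≡ suc m → ∃ λ s → x ≡ topLetter s m
abs≡⇒topLetter (ℤ.+ .(suc m)) m refl = true , refl
abs≡⇒topLetter -[1+ n ]       m e    = false , cong -[1+_] (suc-injective e)

topLetter-fresh : ∀ s m x → ∣ x ∣ ≤ m → topLetter s m ≢ x
topLetter-fresh s m x x≤m refl = <⇒≱ ≤-refl (subst (_≤ m) (abs-topLetter s m) x≤m)

-- The 2m+2 ways to insert the top letter into a window π of size m:
-- append ±(m+1) at the end, or, for i < m, put ±(m+1) at position |π_{i+1}|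
-- and move the letter found there to the end.
data Insertion : Set where
  append   : Bool → Insertion
  displace : ℕ → Bool → Insertion

Valid : ℕ → Insertion → Set
Valid m (append s)     = ⊤
Valid m (displace i s) = i < m

sign : Insertion → Bool
sign (append s)     = s
sign (displace i s) = s

slot : List ℤ → ℕ → ℕ
slot π i = pred ∣ entry π i ∣

insert : ℕ → List ℤ → Insertion → List ℤ
insert m π (append s)     = π ∷ʳ topLetter s m
insert m π (displace i s) = update π (slot π i) (topLetter s m) ∷ʳ entry π (slot π i)

abs-slot : ∀ {m π} → IsSignedPerm m π → ∀ i → i < m → ∣ entry π i ∣ ≡ suc (slot π i)
abs-slot {π = π} sp i i<m = abs-suc-pred (entry π i) (proj₁ (inRange sp i i<m))

slot< : ∀ {m π} → IsSignedPerm m π → ∀ i → i < m → slot π i < m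
slot< sp i i<m = subst (_≤ _) (abs-slot sp i i<m) (proj₂ (inRange sp i i<m))

snoc-isSignedPerm : ∀ m ws y → length ws ≡ m → (∀ j → j < m → InRange (suc m) (entry ws j)) → InRange (suc m) y →
                    (∀ v → v < suc m → (∃ λ j → j < m × ∣ entry ws j ∣ ≡ suc v) ⊎ ∣ y ∣ ≡ suc v) →
                    IsSignedPerm (suc m) (ws ∷ʳ y)
snoc-isSignedPerm m ws y refl ws∈ y∈ covering = signedPerm (length-snoc ws y) in-range covering′
  where
  in-range : ∀ j → j < suc m → InRange (suc m) (entry (ws ∷ʳ y) j)
  in-range j j≤m with entry-snoc-cases ws y j j≤m
  ... | inj₁ (j<m , e) = subst (InRange (suc m)) (sym e) (ws∈ j j<m)
  ... | inj₂ e         = subst (InRange (suc m)) (sym e) y∈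
  covering′ : ∀ v → v < suc m → ∃ λ j → j < suc m × ∣ entry (ws ∷ʳ y) j ∣ ≡ suc v
  covering′ v v≤m with covering v v≤m
  ... | inj₁ (j , j<m , e) = j , m≤n⇒m≤1+n j<m , trans (cong ∣_∣ (entry-++ˡ ws (y ∷ []) j j<m)) e
  ... | inj₂ e             = m , ≤-refl , trans (cong ∣_∣ (entry-snoc-last ws y)) e

below-or-top : ∀ m (P : ℕ → Set) → (∀ v → v < m → P v) → P m → ∀ v → v < suc m → P v
below-or-top m P below top v v≤m with v ℕ.<? m
... | yes v<m = below v v<m
... | no  v≮m = subst P (sym (≤-antisym (≤-pred v≤m) (≮⇒≥ v≮m))) top

insert-isSignedPerm : ∀ m π c → IsSignedPerm m π → Valid m c → IsSignedPerm (suc m) (insert m π c)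
insert-isSignedPerm m π (append s) sp _ =
  snoc-isSignedPerm m π (topLetter s m) (length≡ sp) (λ j j<m → InRange-suc m (entry π j) (inRange sp j j<m))
    (InRange-topLetter s m) (below-or-top m _ (λ v v<m → inj₁ (covers sp v v<m)) (inj₂ (abs-topLetter s m)))
insert-isSignedPerm m π (displace i s) sp i<m =
  snoc-isSignedPerm m ws (entry π k) (trans (length-update π k _) (length≡ sp)) ws∈ (InRange-suc m (entry π k) (inRange sp k k<m))
    (below-or-top m _ old-values (inj₁ (k , k<m , trans (cong ∣_∣ ws-k) (abs-topLetter s m))))
  where
  k = slot π i
  k<m = slot< sp i i<m
  ws = update π k (topLetter s m)
  ws-k : entry ws k ≡ topLetter s m
  ws-k = entry-update-same π k _ (subst (k <_) (sym (length≡ sp)) k<m)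
  ws∈ : ∀ j → j < m → InRange (suc m) (entry ws j)
  ws∈ j j<m with j ℕ.≟ k
  ... | yes refl = subst (InRange (suc m)) (sym ws-k) (InRange-topLetter s m)
  ... | no  j≢k  = subst (InRange (suc m)) (sym (entry-update-other π k _ j j≢k)) (InRange-suc m (entry π j) (inRange sp j j<m))
  old-values : ∀ v → v < m → (∃ λ j → j < m × ∣ entry ws j ∣ ≡ suc v) ⊎ ∣ entry π k ∣ ≡ suc v
  old-values v v<m with covers sp v v<m
  ... | j , j<m , e with j ℕ.≟ k
  ...   | yes refl = inj₂ e
  ...   | no  j≢k  = inj₁ (j , j<m , trans (cong ∣_∣ (entry-update-other π k _ j j≢k)) e)

-- Two middle insertions giving the same word coincide: the top letter marks
-- the slot, the last letter restores π, and the slot determines i.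
displace-injective : ∀ m {π π′ i i′ s s′} → IsSignedPerm m π → IsSignedPerm m π′ → i < m → i′ < m →
                     insert m π (displace i s) ≡ insert m π′ (displace i′ s′) → π ≡ π′ × displace i s ≡ displace i′ s′
displace-injective m {π} {π′} {i} {i′} {s} {s′} sp sp′ i<m i′<m e
  with LP.∷ʳ-injective (update π (slot π i) (topLetter s m)) (update π′ (slot π′ i′) (topLetter s′ m)) e
... | ws≡ , last≡ = π≡π′ , cong₂ displace i≡i′ s≡s′
  where
  k  = slot π i
  k′ = slot π′ i′
  k<m  = slot< sp i i<m
  k′<m = slot< sp′ i′ i′<m
  ws-k : entry (update π k (topLetter s m)) k ≡ topLetter s m
  ws-k = entry-update-same π k _ (subst (k <_) (sym (length≡ sp)) k<m)
  ws′-k′ : entry (update π′ k′ (topLetter s′ m)) k′ ≡ topLetter s′ m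
  ws′-k′ = entry-update-same π′ k′ _ (subst (k′ <_) (sym (length≡ sp′)) k′<m)
  k≡k′ : k ≡ k′
  k≡k′ with k ℕ.≟ k′
  ... | yes eq   = eq
  ... | no  k≢k′ = ⊥-elim (topLetter-fresh s m (entry π′ k) (proj₂ (inRange sp′ k k<m))
                     (trans (sym ws-k) (trans (cong (λ z → entry z k) ws≡) (entry-update-other π′ k′ _ k k≢k′))))
  s≡s′ : s ≡ s′
  s≡s′ = topLetter-injective m (trans (sym ws-k) (trans (cong (λ z → entry z k) ws≡) (trans (cong (entry (update π′ k′ (topLetter s′ m))) k≡k′) ws′-k′)))
  π≡π′ : π ≡ π′
  π≡π′ = entry-ext π π′ (trans (length≡ sp) (sym (length≡ sp′))) same
    where
    same : ∀ j → j < length π → entry π j ≡ entry π′ j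
    same j _ with j ℕ.≟ k
    ... | yes refl = trans last≡ (cong (entry π′) (sym k≡k′))
    ... | no  j≢k  = trans (sym (entry-update-other π k _ j j≢k))
                       (trans (cong (λ z → entry z j) ws≡) (entry-update-other π′ k′ _ j (λ j≡k′ → j≢k (trans j≡k′ (sym k≡k′)))))
  i≡i′ : i ≡ i′
  i≡i′ = abs-injective sp i i′ i<m i′<m
           (trans (abs-slot sp i i<m) (trans (cong suc k≡k′)
             (sym (trans (cong (λ z → ∣ entry z i′ ∣) π≡π′) (abs-slot sp′ i′ i′<m)))))

insert-injective : ∀ m {π π′ c c′} → IsSignedPerm m π → IsSignedPerm m π′ → Valid m c → Valid m c′ →
                   insert m π c ≡ insert m π′ c′ → π ≡ π′ × c ≡ c′
insert-injective m {π} {π′} {append s} {append s′} _ _ _ _ e with LP.∷ʳ-injective π π′ e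
... | π≡π′ , top≡ = π≡π′ , cong append (topLetter-injective m top≡)
insert-injective m {π} {π′} {append s} {displace i′ s′} _ sp′ _ i′<m e =
  ⊥-elim (topLetter-fresh s m _ (proj₂ (inRange sp′ _ (slot< sp′ i′ i′<m))) (LP.∷ʳ-injectiveʳ π _ e))
insert-injective m {π} {π′} {displace i s} {append s′} sp _ i<m _ e =
  ⊥-elim (topLetter-fresh s′ m _ (proj₂ (inRange sp _ (slot< sp i i<m))) (sym (LP.∷ʳ-injectiveʳ _ π′ e)))
insert-injective m {c = displace i s} {displace i′ s′} sp sp′ i<m i′<m e = displace-injective m sp sp′ i<m i′<m e

removeTop-isSignedPerm : ∀ {m W π k} → IsSignedPerm (suc m) W → k < suc m → ∣ entry W k ∣ ≡ suc m →
                         length π ≡ m → (∀ j → j < m → j ≢ k → entry π j ≡ entry W j) →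
                         (k < m → entry π k ≡ entry W m) → IsSignedPerm m π
removeTop-isSignedPerm {m} {W} {π} {k} spW k≤m Wk-top len off at-k = signedPerm len in-range covering
  where
  shrink : ∀ j → j < suc m → j ≢ k → InRange m (entry W j)
  shrink j j≤m j≢k = InRange-pred m (entry W j) (inRange spW j j≤m) λ Wj-top → j≢k (abs-injective spW j k j≤m k≤m (trans Wj-top (sym Wk-top)))
  in-range : ∀ j → j < m → InRange m (entry π j)
  in-range j j<m with j ℕ.≟ k
  ... | yes refl = subst (InRange m) (sym (at-k j<m)) (shrink m ≤-refl (<⇒≢ j<m ∘ sym))
  ... | no  j≢k  = subst (InRange m) (sym (off j j<m j≢k)) (shrink j (m≤n⇒m≤1+n j<m) j≢k)
  covering : ∀ v → v < m → ∃ λ j → j < m × ∣ entry π j ∣ ≡ suc v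
  covering v v<m with covers spW v (m≤n⇒m≤1+n v<m)
  ... | p , p≤m , Wp≡ with p ℕ.≟ k | p ℕ.≟ m
  ...   | yes refl | _        = ⊥-elim (<⇒≢ v<m (suc-injective (trans (sym Wp≡) Wk-top)))
  ...   | no  p≢k  | yes refl = k , k<m , trans (cong ∣_∣ (at-k k<m)) Wp≡
    where k<m = ≤∧≢⇒< (≤-pred k≤m) (p≢k ∘ sym)
  ...   | no  p≢k  | no  p≢m  = p , p<m , trans (cong ∣_∣ (off p p<m p≢k)) Wp≡
    where p<m = ≤-pred (≤∧≢⇒< p≤m (p≢m ∘ suc-injective))

-- Every signed permutation of size m+1 is an insertion into one of size m:
-- if its last letter is ±(m+1) it is an append, otherwise the top letter sits
-- at some slot k < m and is a displacement.
insert-surjective : ∀ m W → IsSignedPerm (suc m) W → ∃₂ λ π c → IsSignedPerm m π × Valid m c × W ≡ insert m π c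
insert-surjective m W spW with snoc-view m W (length≡ spW)
... | ws , y , refl , len = by-last-letter (∣ y ∣ ℕ.≟ suc m)
  where
  W-last : entry (ws ∷ʳ y) m ≡ y
  W-last = subst (λ z → entry (ws ∷ʳ y) z ≡ y) len (entry-snoc-last ws y)
  W-init : ∀ j → j < m → entry (ws ∷ʳ y) j ≡ entry ws j
  W-init j j<m = entry-++ˡ ws (y ∷ []) j (subst (j <_) (sym len) j<m)
  by-last-letter : Dec (∣ y ∣ ≡ suc m) → ∃₂ λ π c → IsSignedPerm m π × Valid m c × ws ∷ʳ y ≡ insert m π c
  by-last-letter (yes y-top) = ws , append s , spπ , tt , cong (ws ∷ʳ_) y≡
    where
    s  = proj₁ (abs≡⇒topLetter y m y-top)
    y≡ = proj₂ (abs≡⇒topLetter y m y-top)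
    spπ : IsSignedPerm m ws
    spπ = removeTop-isSignedPerm spW ≤-refl (trans (cong ∣_∣ W-last) y-top) len
            (λ j j<m _ → sym (W-init j j<m)) (λ m<m → ⊥-elim (<-irrefl refl m<m))
  by-last-letter (no y-not-top) = π , displace i s , spπ , i<m , W≡
    where
    k       = proj₁ (covers spW m ≤-refl)
    k≤m     = proj₁ (proj₂ (covers spW m ≤-refl))
    Wk-top  = proj₂ (proj₂ (covers spW m ≤-refl))
    k<m : k < m
    k<m = ≤∧≢⇒< (≤-pred k≤m) λ k≡m → y-not-top (trans (cong ∣_∣ (sym W-last)) (subst (λ z → ∣ entry (ws ∷ʳ y) z ∣ ≡ suc m) k≡m Wk-top))
    sk = abs≡⇒topLetter (entry ws k) m (trans (cong ∣_∣ (sym (W-init k k<m))) Wk-top)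
    s  = proj₁ sk
    π  = update ws k y
    k<ws : k < length ws
    k<ws = subst (k <_) (sym len) k<m
    π-k : entry π k ≡ y
    π-k = entry-update-same ws k y k<ws
    spπ : IsSignedPerm m π
    spπ = removeTop-isSignedPerm spW k≤m Wk-top (trans (length-update ws k y) len)
            (λ j j<m j≢k → trans (entry-update-other ws k y j j≢k) (sym (W-init j j<m)))
            (λ _ → trans π-k (sym W-last))
    i   = proj₁ (covers spπ k k<m)
    i<m = proj₁ (proj₂ (covers spπ k k<m))
    slot≡k : slot π i ≡ k
    slot≡k = cong pred (proj₂ (proj₂ (covers spπ k k<m)))
    W≡ : ws ∷ʳ y ≡ insert m π (displace i s)
    W≡ = begin
        ws ∷ʳ y                                ≡⟨ cong (_∷ʳ y) (sym (update-entry ws k)) ⟩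
        update ws k (entry ws k) ∷ʳ y          ≡⟨ cong (λ z → update ws k z ∷ʳ y) (proj₂ sk) ⟩
        update ws k (topLetter s m) ∷ʳ y       ≡⟨ cong₂ _∷ʳ_ (sym (update-update ws k y (topLetter s m))) (sym π-k) ⟩
        update π k (topLetter s m) ∷ʳ entry π k ≡⟨ cong (λ z → update π z (topLetter s m) ∷ʳ entry π z) (sym slot≡k) ⟩
        insert m π (displace i s)              ∎
      where open ≡-Reasoning

-- Decomposing counts over 𝔅_{m+1} along the insertions

insertions : ℕ → List Insertion
insertions m = append true ∷ append false ∷ concatMap (λ i → displace i true ∷ displace i false ∷ []) (upTo m)

children : ℕ → List ℤ → List (List ℤ)
children m π = map (insert m π) (insertions m)

bothSigns : (Insertion → Bool) → ℕ → ℕ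
bothSigns g i = 𝟙 (g (displace i true)) + (𝟙 (g (displace i false)) + 0)

count-insertions : ∀ (g : Insertion → Bool) m →
  count g (insertions m) ≡ 𝟙 (g (append true)) + (𝟙 (g (append false)) + sumBelow m (bothSigns g))
count-insertions g m = cong (λ z → 𝟙 (g (append true)) + (𝟙 (g (append false)) + z))
  (trans (count-concatMap g (λ i → displace i true ∷ displace i false ∷ []) (upTo m)) (sumOver-applyUpTo _ (λ i → i) m))

count-insertions-cong : ∀ (g g′ : Insertion → Bool) m → (∀ c → Valid m c → g c ≡ g′ c) →
                        count g (insertions m) ≡ count g′ (insertions m)
count-insertions-cong g g′ m h = begin
    count g (insertions m)
      ≡⟨ count-insertions g m ⟩
    𝟙 (g (append true)) + (𝟙 (g (append false)) + sumBelow m (bothSigns g))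
      ≡⟨ cong₂ (λ a b → 𝟙 a + (𝟙 b + sumBelow m (bothSigns g))) (h (append true) tt) (h (append false) tt) ⟩
    𝟙 (g′ (append true)) + (𝟙 (g′ (append false)) + sumBelow m (bothSigns g))
      ≡⟨ cong (λ z → 𝟙 (g′ (append true)) + (𝟙 (g′ (append false)) + z))
              (sumBelow-cong m λ i i<m → cong₂ (λ a b → 𝟙 a + (𝟙 b + 0)) (h (displace i true) i<m) (h (displace i false) i<m)) ⟩
    𝟙 (g′ (append true)) + (𝟙 (g′ (append false)) + sumBelow m (bothSigns g′))
      ≡⟨ sym (count-insertions g′ m) ⟩
    count g′ (insertions m) ∎
  where open ≡-Reasoning

_≟ᴵ_ : (c d : Insertion) → Dec (c ≡ d)
append a     ≟ᴵ append b with a Data.Bool.≟ b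
  where import Data.Bool
... | yes refl = yes refl
... | no  a≢b  = no λ { refl → a≢b refl }
append a     ≟ᴵ displace j b = no λ ()
displace i a ≟ᴵ append b     = no λ ()
displace i a ≟ᴵ displace j b with i ℕ.≟ j | a Data.Bool.≟ b
  where import Data.Bool
... | yes refl | yes refl = yes refl
... | no  i≢j  | _        = no λ { refl → i≢j refl }
... | yes _    | no  a≢b  = no λ { refl → a≢b refl }

eqᴵ : Insertion → Insertion → Bool
eqᴵ c d = ⌊ c ≟ᴵ d ⌋

count-insertions-single : ∀ m c → Valid m c → count (eqᴵ c) (insertions m) ≡ 1
count-insertions-single m c valid = trans (count-insertions (eqᴵ c) m) (by-kind c valid)
  where
  no-displace : ∀ s → sumBelow m (bothSigns (eqᴵ (append s))) ≡ 0
  no-displace s = trans (sumBelow-cong m λ i _ → cong₂ (λ a b → 𝟙 a + (𝟙 b + 0))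
                          (dec-false (append s ≟ᴵ displace i true) λ ()) (dec-false (append s ≟ᴵ displace i false) λ ()))
                        (sumBelow-zero m)
  at-index : ∀ i₀ s₀ i → i < m → bothSigns (eqᴵ (displace i₀ s₀)) i ≡ 𝟙 (eqℕ i i₀)
  at-index i₀ s₀ i _ with i ℕ.≟ i₀
  at-index i₀ true  i _ | yes refl = cong₂ (λ a b → 𝟙 a + (𝟙 b + 0)) (dec-true (displace i true ≟ᴵ displace i true) refl)
                                                                      (dec-false (displace i true ≟ᴵ displace i false) λ ())
  at-index i₀ false i _ | yes refl = cong₂ (λ a b → 𝟙 a + (𝟙 b + 0)) (dec-false (displace i false ≟ᴵ displace i true) λ ())
                                                                      (dec-true (displace i false ≟ᴵ displace i false) refl)
  at-index i₀ s₀    i _ | no i≢i₀  = cong₂ (λ a b → 𝟙 a + (𝟙 b + 0))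
                                       (dec-false (displace i₀ s₀ ≟ᴵ displace i true) λ { refl → i≢i₀ refl })
                                       (dec-false (displace i₀ s₀ ≟ᴵ displace i false) λ { refl → i≢i₀ refl })
  by-kind : ∀ c → Valid m c → 𝟙 (eqᴵ c (append true)) + (𝟙 (eqᴵ c (append false)) + sumBelow m (bothSigns (eqᴵ c))) ≡ 1
  by-kind (append true) _ =
    trans (cong₂ (λ a b → 𝟙 a + (𝟙 b + sumBelow m (bothSigns (eqᴵ (append true)))))
                 (dec-true (append true ≟ᴵ append true) refl) (dec-false (append true ≟ᴵ append false) λ ()))
          (cong suc (no-displace true))
  by-kind (append false) _ =
    trans (cong₂ (λ a b → 𝟙 a + (𝟙 b + sumBelow m (bothSigns (eqᴵ (append false)))))
                 (dec-false (append false ≟ᴵ append true) λ ()) (dec-true (append false ≟ᴵ append false) refl))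
          (cong suc (no-displace false))
  by-kind (displace i₀ s₀) i₀<m =
    trans (cong₂ (λ a b → 𝟙 a + (𝟙 b + sumBelow m (bothSigns (eqᴵ (displace i₀ s₀)))))
                 (dec-false (displace i₀ s₀ ≟ᴵ append true) λ ()) (dec-false (displace i₀ s₀ ≟ᴵ append false) λ ()))
          (trans (sumBelow-cong m (at-index i₀ s₀)) (sumBelow-point m i₀ i₀<m))

mult-children-outside : ∀ m w π → ¬ IsSignedPerm (suc m) w → IsSignedPerm m π → mult w (children m π) ≡ 0
mult-children-outside m w π w∉ sp =
  trans (count-map (eqL w) (insert m π) (insertions m))
    (trans (count-insertions-cong _ (λ _ → false) m never) (trans (count-insertions (λ _ → false) m) (sumBelow-zero m)))
  where
  never : ∀ c → Valid m c → eqL w (insert m π c) ≡ false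
  never c valid with eqL w (insert m π c) in e
  ... | true  = ⊥-elim (w∉ (subst (IsSignedPerm (suc m)) (sym (eqL-true⇒ e)) (insert-isSignedPerm m π c sp valid)))
  ... | false = refl

mult-children-inside : ∀ m π₀ c₀ π → IsSignedPerm m π₀ → Valid m c₀ → IsSignedPerm m π →
                       mult (insert m π₀ c₀) (children m π) ≡ 𝟙 (eqL π₀ π)
mult-children-inside m π₀ c₀ π sp₀ valid₀ sp = begin
    mult (insert m π₀ c₀) (children m π)                    ≡⟨ count-map (eqL (insert m π₀ c₀)) (insert m π) (insertions m) ⟩
    count (λ c → eqL (insert m π₀ c₀) (insert m π c)) (insertions m) ≡⟨ count-insertions-cong _ _ m same-child ⟩
    count (λ c → eqL π₀ π ∧ eqᴵ c₀ c) (insertions m)       ≡⟨ count-const-∧ (eqL π₀ π) (eqᴵ c₀) (insertions m) ⟩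
    𝟙 (eqL π₀ π) * count (eqᴵ c₀) (insertions m)           ≡⟨ cong (𝟙 (eqL π₀ π) *_) (count-insertions-single m c₀ valid₀) ⟩
    𝟙 (eqL π₀ π) * 1                                        ≡⟨ *-identityʳ _ ⟩
    𝟙 (eqL π₀ π)                                            ∎
  where
  open ≡-Reasoning
  same-child : ∀ c → Valid m c → eqL (insert m π₀ c₀) (insert m π c) ≡ (eqL π₀ π ∧ eqᴵ c₀ c)
  same-child c valid = bool-ext ⇒ ⇐
    where
    ⇒ : eqL (insert m π₀ c₀) (insert m π c) ≡ true → (eqL π₀ π ∧ eqᴵ c₀ c) ≡ true
    ⇒ e with insert-injective m sp₀ sp valid₀ valid (eqL-true⇒ e)
    ... | π₀≡π , c₀≡c = true-∧-true (dec-true (LP.≡-dec ℤP._≟_ π₀ π) π₀≡π) (dec-true (c₀ ≟ᴵ c) c₀≡c)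
    ⇐ : (eqL π₀ π ∧ eqᴵ c₀ c) ≡ true → eqL (insert m π₀ c₀) (insert m π c) ≡ true
    ⇐ e with ∧-true⇒ {eqL π₀ π} e
    ... | e₁ , e₂ = dec-true (LP.≡-dec ℤP._≟_ _ _) (cong₂ (insert m) (eqL-true⇒ e₁) (does-true⇒ (c₀ ≟ᴵ c) e₂))

mult-Bn-suc : ∀ m w → mult w (Bn (suc m)) ≡ mult w (concatMap (children m) (Bn m))
mult-Bn-suc m w = trans (mult-Bn (suc m) w) (sym (trans (count-concatMap (eqL w) (children m) (Bn m)) (by-membership _ refl)))
  where
  by-membership : ∀ b → isSignedPermᵇ (suc m) w ≡ b → sumOver (λ π → mult w (children m π)) (Bn m) ≡ 𝟙 b
  by-membership true e with insert-surjective m w (isSignedPermᵇ⇒ (suc m) w e)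
  ... | π₀ , c₀ , sp₀ , valid₀ , refl = begin
      sumOver (λ π → mult (insert m π₀ c₀) (children m π)) (Bn m)
        ≡⟨ sumOver-congᴬˡˡ (Bn m) (Bn-signedPerms m) (λ π sp → mult-children-inside m π₀ c₀ π sp₀ valid₀ sp) ⟩
      sumOver (𝟙 ∘ eqL π₀) (Bn m)  ≡⟨ sym (count≡sumOver (eqL π₀) (Bn m)) ⟩
      mult π₀ (Bn m)               ≡⟨ mult-Bn m π₀ ⟩
      𝟙 (isSignedPermᵇ m π₀)       ≡⟨ cong 𝟙 (⇒isSignedPermᵇ m π₀ sp₀) ⟩
      1                            ∎
    where open ≡-Reasoning
  by-membership false e =
    trans (sumOver-congᴬˡˡ (Bn m) (Bn-signedPerms m) (λ π sp → mult-children-outside m w π w∉ sp)) (sumOver-zero (Bn m))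
    where
    w∉ : ¬ IsSignedPerm (suc m) w
    w∉ spw with () ← trans (sym e) (⇒isSignedPermᵇ (suc m) w spw)

count-Bn-suc : ∀ m (p : List ℤ → Bool) → count p (Bn (suc m)) ≡ sumOver (count p ∘ children m) (Bn m)
count-Bn-suc m p =
  trans (count-from-mult (Bn (suc m)) (concatMap (children m) (Bn m)) (mult-Bn-suc m) p) (count-concatMap p (children m) (Bn m))

-- How an insertion changes exc

ltb : ℤ → ℤ → Bool
ltb x y = ⌊ x ℤP.<? y ⌋

ltb-irrefl : ∀ x → ltb x x ≡ false
ltb-irrefl x = dec-false (x ℤP.<? x) (ℤP.<-irrefl refl)

isNegFixed : ℤ → ℕ → Bool
isNegFixed x j = ⌊ x ℤP.≟ ℤ.- (ℤ.+ suc j) ⌋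

not-negFixed : ∀ x j → ∣ x ∣ ≢ suc j → isNegFixed x j ≡ false
not-negFixed x j |x|≢ = dec-false (x ℤP.≟ ℤ.- (ℤ.+ suc j)) (|x|≢ ∘ cong ∣_∣)

climb-via : ∀ W j x a → entry W j ≡ x → ∣ x ∣ ≡ suc a → climb W j ≡ ltb x (entry W a)
climb-via W j x a refl |x|≡ rewrite |x|≡ = refl

excAt-via : ∀ W j x a → entry W j ≡ x → ∣ x ∣ ≡ suc a → excAt W j ≡ 𝟙 (ltb x (entry W a)) + 𝟙 (isNegFixed x j)
excAt-via W j x a refl |x|≡ = cong (λ b → 𝟙 b + 𝟙 (isNegFixed (entry W j) j)) (climb-via W j (entry W j) a refl |x|≡)

excAt-climb : ∀ W j x a → entry W j ≡ x → ∣ x ∣ ≡ suc a → ∣ x ∣ ≢ suc j → excAt W j ≡ 𝟙 (ltb x (entry W a))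
excAt-climb W j x a Wj |x|≡ |x|≢ =
  trans (excAt-via W j x a Wj |x|≡) (trans (cong (λ b → 𝟙 (ltb x (entry W a)) + 𝟙 b) (not-negFixed x j |x|≢)) (+-identityʳ _))

excAt-same : ∀ W V j a → entry W j ≡ entry V j → ∣ entry V j ∣ ≡ suc a → entry W a ≡ entry V a → excAt W j ≡ excAt V j
excAt-same W V j a Wj≡Vj |Vj|≡ Wa≡Va = trans (excAt-via W j (entry V j) a Wj≡Vj |Vj|≡)
  (trans (cong (λ z → 𝟙 (ltb (entry V j) z) + _) Wa≡Va) (sym (excAt-via V j (entry V j) a refl |Vj|≡)))

-- A position contributes at most 1: a letter -(j+1) at j is its own slot, hence no climb.
excAt≤1 : ∀ {m π} → IsSignedPerm m π → ∀ i → i < m → excAt π i ≤ 1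
excAt≤1 {π = π} sp i i<m with negFixed π i in nf
... | false = subst (_≤ 1) (sym (+-identityʳ _)) (𝟙≤1 (climb π i))
... | true  = subst (λ b → 𝟙 b + 1 ≤ 1) (sym no-climb) ≤-refl
  where
  πi≡ : entry π i ≡ ℤ.- (ℤ.+ suc i)
  πi≡ = does-true⇒ (entry π i ℤP.≟ ℤ.- (ℤ.+ suc i)) nf
  no-climb : climb π i ≡ false
  no-climb = trans (climb-via π i _ i πi≡ refl) (trans (cong (ltb _) πi≡) (ltb-irrefl _))

<-top : ∀ x m → ∣ x ∣ ≤ m → x ℤ.< ℤ.+ suc m
<-top (ℤ.+ n)  m |x|≤m = ℤ.+<+ (s≤s |x|≤m)
<-top -[1+ n ] m |x|≤m = ℤ.-<+

bottom-< : ∀ x m → ∣ x ∣ ≤ m → -[1+ m ] ℤ.< x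
bottom-< (ℤ.+ n)  m |x|≤m = ℤ.-<+
bottom-< -[1+ n ] m |x|≤m = ℤ.-<- |x|≤m

ltb-topLetter : ∀ x s m → ∣ x ∣ ≤ m → ltb x (topLetter s m) ≡ s
ltb-topLetter x true  m |x|≤m = dec-true (x ℤP.<? ℤ.+ suc m) (<-top x m |x|≤m)
ltb-topLetter x false m |x|≤m = dec-false (x ℤP.<? -[1+ m ]) (ℤP.<-asym (bottom-< x m |x|≤m))

topLetter-ltb : ∀ y s m → ∣ y ∣ ≤ m → ltb (topLetter s m) y ≡ not s
topLetter-ltb y true  m |y|≤m = dec-false (ℤ.+ suc m ℤP.<? y) (ℤP.<-asym (<-top y m |y|≤m))
topLetter-ltb y false m |y|≤m = dec-true (-[1+ m ] ℤP.<? y) (bottom-< y m |y|≤m)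

isNegFixed-topLetter : ∀ s m → isNegFixed (topLetter s m) m ≡ not s
isNegFixed-topLetter true  m = dec-false (topLetter true m ℤP.≟ ℤ.- (ℤ.+ suc m)) λ ()
isNegFixed-topLetter false m = dec-true (topLetter false m ℤP.≟ ℤ.- (ℤ.+ suc m)) refl

exc-append : ∀ m π s → IsSignedPerm m π → exc (insert m π (append s)) ≡ exc π + 𝟙 (not s)
exc-append m π s sp = begin
    exc W                              ≡⟨ exc≡sumBelow W (suc m) (trans (length-snoc π (topLetter s m)) (cong suc (length≡ sp))) ⟩
    sumBelow (suc m) (excAt W)         ≡⟨ sumBelow-snoc m (excAt W) ⟩
    sumBelow m (excAt W) + excAt W m   ≡⟨ cong₂ _+_ (sumBelow-cong m old) new ⟩
    sumBelow m (excAt π) + 𝟙 (not s)   ≡⟨ cong (_+ 𝟙 (not s)) (sym (exc≡sumBelow π m (length≡ sp))) ⟩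
    exc π + 𝟙 (not s)                  ∎
  where
  open ≡-Reasoning
  W = π ∷ʳ topLetter s m
  W-init : ∀ j → j < m → entry W j ≡ entry π j
  W-init j j<m = entry-++ˡ π (topLetter s m ∷ []) j (subst (j <_) (sym (length≡ sp)) j<m)
  W-last : entry W m ≡ topLetter s m
  W-last = subst (λ z → entry W z ≡ topLetter s m) (length≡ sp) (entry-snoc-last π (topLetter s m))
  old : ∀ j → j < m → excAt W j ≡ excAt π j
  old j j<m = excAt-same W π j (slot π j) (W-init j j<m) (abs-slot sp j j<m) (W-init (slot π j) (slot< sp j j<m))
  -- the new letter is its own slot: no climb, and a negative fixed point iff negative
  new : excAt W m ≡ 𝟙 (not s)
  new = trans (excAt-via W m (topLetter s m) m W-last (abs-topLetter s m))
              (cong₂ (λ a b → 𝟙 a + 𝟙 b) (trans (cong (ltb (topLetter s m)) W-last) (ltb-irrefl (topLetter s m)))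
                                         (isNegFixed-topLetter s m))

-- Let k = slot π i and W = insert m π (displace i s):
-- W carries ±(m+1) at k, the old letter y = π_k at the end, and agrees with
-- π elsewhere.  Only positions i, k and m of W can differ in excAt, and the
-- upshot is exc W + excAt π i = exc π + 1.
module Displacement {m π} (sp : IsSignedPerm m π) (i : ℕ) (i<m : i < m) (s : Bool) where

  private
    k   = slot π i
    k<m = slot< sp i i<m
    top = topLetter s m
    y   = entry π k
    V   = update π k top
    W   = V ∷ʳ y

    V-length : length V ≡ m
    V-length = trans (length-update π k top) (length≡ sp)

    W-init : ∀ j → j < m → entry W j ≡ entry V j
    W-init j j<m = entry-++ˡ V (y ∷ []) j (subst (j <_) (sym V-length) j<m)

    W-last : entry W m ≡ y
    W-last = subst (λ z → entry W z ≡ y) V-length (entry-snoc-last V y)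

    W-k : entry W k ≡ top
    W-k = trans (W-init k k<m) (entry-update-same π k top (subst (k <_) (sym (length≡ sp)) k<m))

    W-other : ∀ j → j < m → j ≢ k → entry W j ≡ entry π j
    W-other j j<m j≢k = trans (W-init j j<m) (entry-update-other π k top j j≢k)

    |πi|≡ : ∣ entry π i ∣ ≡ suc k
    |πi|≡ = abs-slot sp i i<m

    small : ∀ j → j < m → ∣ entry π j ∣ ≤ m
    small j j<m = proj₂ (inRange sp j j<m)

    y-not-top : ∣ y ∣ ≢ suc m
    y-not-top |y|≡ = <⇒≱ ≤-refl (subst (_≤ m) |y|≡ (small k k<m))

    excW : exc W ≡ sumBelow m (excAt W) + excAt W m
    excW = trans (exc≡sumBelow W (suc m) (trans (length-snoc V y) (cong suc V-length))) (sumBelow-snoc m (excAt W))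

    excπ : exc π ≡ sumBelow m (excAt π)
    excπ = exc≡sumBelow π m (length≡ sp)

    -- positions other than i and k keep their letter and the letter at their slot
    unchanged : ∀ j → j < m → j ≢ i → j ≢ k → excAt W j ≡ excAt π j
    unchanged j j<m j≢i j≢k =
      excAt-same W π j b (W-other j j<m j≢k) (abs-slot sp j j<m) (W-other b (slot< sp j j<m) b≢k)
      where
      b = slot π j
      b≢k : b ≢ k
      b≢k b≡k = j≢i (abs-injective sp j i j<m i<m (trans (abs-slot sp j j<m) (trans (cong suc b≡k) (sym |πi|≡))))

    -- the top letter at k has the displaced letter y at its slot m
    excW-k : excAt W k ≡ 𝟙 (not s)
    excW-k = trans (excAt-climb W k top m W-k (abs-topLetter s m) (<⇒≢ (s≤s k<m) ∘ sym ∘ trans (sym (abs-topLetter s m))))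
                   (cong 𝟙 (trans (cong (ltb top) W-last) (topLetter-ltb y s m (small k k<m))))

    -- when the letter at i points to itself, W ends with it and it now faces the top letter
    excW-last-fixed : i ≡ k → excAt W m ≡ 𝟙 s
    excW-last-fixed i≡k =
      trans (excAt-climb W m y k W-last (trans (cong (λ z → ∣ entry π z ∣) (sym i≡k)) |πi|≡) y-not-top)
            (cong 𝟙 (trans (cong (ltb y) W-k) (ltb-topLetter y s m (small k k<m))))

    exc-displace-fixed : i ≡ k → exc W + excAt π i ≡ suc (exc π)
    exc-displace-fixed i≡k = begin
        exc W + excAt π i                                      ≡⟨ cong (_+ excAt π i) excW ⟩
        sumBelow m (excAt W) + excAt W m + excAt π i           ≡⟨ cong (λ z → sumBelow m (excAt W) + z + excAt π i) (excW-last-fixed i≡k) ⟩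
        sumBelow m (excAt W) + 𝟙 s + excAt π i                 ≡⟨ xy∙z≈xz∙y (sumBelow m (excAt W)) (𝟙 s) (excAt π i) ⟩
        sumBelow m (excAt W) + excAt π i + 𝟙 s                 ≡⟨ cong (_+ 𝟙 s) (sumBelow-change₁ m i i<m λ j j<m j≢i → unchanged j j<m j≢i (j≢i ∘ flip-k j)) ⟩
        sumBelow m (excAt π) + excAt W i + 𝟙 s                 ≡⟨ cong (λ z → sumBelow m (excAt π) + z + 𝟙 s) (trans (cong (excAt W) i≡k) excW-k) ⟩
        sumBelow m (excAt π) + 𝟙 (not s) + 𝟙 s                 ≡⟨ trans (+-assoc (sumBelow m (excAt π)) _ _) (cong (sumBelow m (excAt π) +_) (trans (+-comm (𝟙 (not s)) (𝟙 s)) (𝟙-not s))) ⟩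
        sumBelow m (excAt π) + 1                               ≡⟨ trans (+-comm _ 1) (cong suc (sym excπ)) ⟩
        suc (exc π)                                            ∎
      where
      open ≡-Reasoning
      flip-k : ∀ j → j ≡ k → j ≡ i
      flip-k j j≡k = trans j≡k (sym i≡k)

    -- when i ≠ k, the letter at i now points to the top letter ...
    excW-i : i ≢ k → excAt W i ≡ 𝟙 s
    excW-i i≢k = trans (excAt-climb W i (entry π i) k (W-other i i<m i≢k) |πi|≡ (i≢k ∘ sym ∘ suc-injective ∘ trans (sym |πi|≡)))
                       (cong 𝟙 (trans (cong (ltb (entry π i)) W-k) (ltb-topLetter (entry π i) s m (small i i<m))))

    -- ... and the displaced letter y keeps the letter at its slot, so it behaves as it did at k
    excW-last : i ≢ k → excAt W m ≡ excAt π k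
    excW-last i≢k = begin
        excAt W m                        ≡⟨ excAt-climb W m y b W-last |y|≡ y-not-top ⟩
        𝟙 (ltb y (entry W b))            ≡⟨ cong (𝟙 ∘ ltb y) (W-other b (slot< sp k k<m) b≢k) ⟩
        𝟙 (ltb y (entry π b))            ≡⟨ sym (excAt-climb π k y b refl |y|≡ (b≢k ∘ suc-injective ∘ trans (sym |y|≡))) ⟩
        excAt π k                        ∎
      where
      open ≡-Reasoning
      b = slot π k
      |y|≡ : ∣ y ∣ ≡ suc b
      |y|≡ = abs-slot sp k k<m
      b≢k : b ≢ k
      b≢k b≡k = i≢k (abs-injective sp i k i<m k<m (trans |πi|≡ (trans (cong suc (sym b≡k)) (sym |y|≡))))

    exc-displace-moved : i ≢ k → exc W + excAt π i ≡ suc (exc π)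
    exc-displace-moved i≢k = begin
        exc W + excAt π i                                  ≡⟨ cong (_+ excAt π i) excW ⟩
        sumBelow m (excAt W) + excAt W m + excAt π i       ≡⟨ cong (λ z → sumBelow m (excAt W) + z + excAt π i) (excW-last i≢k) ⟩
        sumBelow m (excAt W) + excAt π k + excAt π i       ≡⟨ xy∙z≈xz∙y (sumBelow m (excAt W)) (excAt π k) (excAt π i) ⟩
        sumBelow m (excAt W) + excAt π i + excAt π k       ≡⟨ sumBelow-change₂ m i k i<m k<m i≢k unchanged ⟩
        sumBelow m (excAt π) + excAt W i + excAt W k       ≡⟨ cong₂ (λ a b → sumBelow m (excAt π) + a + b) (excW-i i≢k) excW-k ⟩
        sumBelow m (excAt π) + 𝟙 s + 𝟙 (not s)             ≡⟨ trans (+-assoc (sumBelow m (excAt π)) _ _) (cong (sumBelow m (excAt π) +_) (𝟙-not s)) ⟩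
        sumBelow m (excAt π) + 1                           ≡⟨ trans (+-comm _ 1) (cong suc (sym excπ)) ⟩
        suc (exc π)                                        ∎
      where open ≡-Reasoning

  exc-displace : exc (insert m π (displace i s)) + excAt π i ≡ suc (exc π)
  exc-displace with i ℕ.≟ slot π i
  ... | yes i≡k = exc-displace-fixed i≡k
  ... | no  i≢k = exc-displace-moved i≢k

-- How an insertion changes the parity of the number of negative entries

sameAs : Bool → Bool → Bool
sameAs true  x = x
sameAs false x = not x

isNeg-topLetter : ∀ s m → isNeg (topLetter s m) ≡ not s
isNeg-topLetter true  m = dec-false (ℤ.+ suc m ℤP.<? ℤ.+ 0) λ { (ℤ.+<+ ()) }
isNeg-topLetter false m = dec-true (-[1+ m ] ℤP.<? ℤ.+ 0) ℤ.-<+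

neg-insert : ∀ m π c → IsSignedPerm m π → Valid m c → neg (insert m π c) ≡ neg π + 𝟙 (not (sign c))
neg-insert m π (append s) sp _ = begin
    neg (π ∷ʳ topLetter s m)                        ≡⟨ length-filter isNeg (π ∷ʳ topLetter s m) ⟩
    count isNeg (π ∷ʳ topLetter s m)                ≡⟨ count-snoc isNeg π (topLetter s m) ⟩
    count isNeg π + 𝟙 (isNeg (topLetter s m))       ≡⟨ cong₂ (λ a b → a + 𝟙 b) (sym (length-filter isNeg π)) (isNeg-topLetter s m) ⟩
    neg π + 𝟙 (not s)                               ∎
  where open ≡-Reasoning
neg-insert m π (displace i s) sp i<m = begin
    neg (update π k (topLetter s m) ∷ʳ entry π k)                       ≡⟨ length-filter isNeg (update π k (topLetter s m) ∷ʳ entry π k) ⟩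
    count isNeg (update π k (topLetter s m) ∷ʳ entry π k)               ≡⟨ count-snoc isNeg (update π k (topLetter s m)) (entry π k) ⟩
    count isNeg (update π k (topLetter s m)) + 𝟙 (isNeg (entry π k))    ≡⟨ count-update isNeg π k (topLetter s m) (subst (k <_) (sym (length≡ sp)) (slot< sp i i<m)) ⟩
    count isNeg π + 𝟙 (isNeg (topLetter s m))                           ≡⟨ cong₂ (λ a b → a + 𝟙 b) (sym (length-filter isNeg π)) (isNeg-topLetter s m) ⟩
    neg π + 𝟙 (not s)                                                   ∎
  where
  open ≡-Reasoning
  k = slot π i

isEven-+-𝟙-not : ∀ a s → isEven (a + 𝟙 (not s)) ≡ sameAs s (isEven a)
isEven-+-𝟙-not a true  = cong isEven (+-identityʳ a)
isEven-+-𝟙-not a false = cong isEven (+-comm a 1)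

parity-insert : ∀ m π c → IsSignedPerm m π → Valid m c → isEven (neg (insert m π c)) ≡ sameAs (sign c) (isEven (neg π))
parity-insert m π c sp valid = trans (cong isEven (neg-insert m π c sp valid)) (isEven-+-𝟙-not (neg π) (sign c))

-- exc π ≤ m, since every position contributes at most 1.
exc≤size : ∀ {m π} → IsSignedPerm m π → exc π ≤ m
exc≤size {m} {π} sp = subst₂ _≤_ (sym (exc≡sumBelow π m (length≡ sp))) (sumBelow-ones m)
                             (sumBelow-mono m (excAt≤1 sp))

exc-displace : ∀ {m π} → IsSignedPerm m π → ∀ i s → i < m → exc (insert m π (displace i s)) ≡ suc (exc π) ∸ excAt π i
exc-displace {π = π} sp i s i<m =
  trans (sym (m+n∸n≡m _ (excAt π i))) (cong (_∸ excAt π i) (Displacement.exc-displace sp i i<m s))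

-- The two displacements at one index have opposite parities and equal exc.
bothParities : (Bool → ℕ → Bool) → Bool → ℕ → ℕ
bothParities h b x = 𝟙 (h b x) + (𝟙 (h (not b) x) + 0)

bothParities-split : ∀ h b e c → c ≤ 1 →
                     bothParities h b (suc e ∸ c) ≡ c * bothParities h b e + (1 ∸ c) * bothParities h b (suc e)
bothParities-split h b e zero          _         = sym (+-identityʳ (bothParities h b (suc e)))
bothParities-split h b e (suc zero)    _         = sym (trans (+-identityʳ _) (+-identityʳ _))
bothParities-split h b e (suc (suc c)) (s≤s ())

-- Counting the children of π with respect to any condition h on (parity, exc):
-- appending +(m+1) gives (b, e), appending -(m+1) gives (not b, e+1), and the
-- m displacement pairs give e pairs at exc e and m - e pairs at exc e+1.
count-children : ∀ m π (h : Bool → ℕ → Bool) → IsSignedPerm m π →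
  count (λ w → h (isEven (neg w)) (exc w)) (children m π)
  ≡ 𝟙 (h (isEven (neg π)) (exc π)) + (𝟙 (h (not (isEven (neg π))) (suc (exc π)))
      + (exc π * bothParities h (isEven (neg π)) (exc π) + (m ∸ exc π) * bothParities h (isEven (neg π)) (suc (exc π))))
count-children m π h sp = begin
    count P (children m π)
      ≡⟨ count-map P (insert m π) (insertions m) ⟩
    count (P ∘ insert m π) (insertions m)
      ≡⟨ count-insertions (P ∘ insert m π) m ⟩
    𝟙 (P (insert m π (append true))) + (𝟙 (P (insert m π (append false))) + sumBelow m (bothSigns (P ∘ insert m π)))
      ≡⟨ cong₂ (λ u v → 𝟙 u + (𝟙 v + sumBelow m (bothSigns (P ∘ insert m π)))) appended₊ appended₋ ⟩
    𝟙 (h b e) + (𝟙 (h (not b) (suc e)) + sumBelow m (bothSigns (P ∘ insert m π)))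
      ≡⟨ cong (λ z → 𝟙 (h b e) + (𝟙 (h (not b) (suc e)) + z)) displaced ⟩
    𝟙 (h b e) + (𝟙 (h (not b) (suc e)) + (e * bothParities h b e + (m ∸ e) * bothParities h b (suc e))) ∎
  where
  open ≡-Reasoning
  P : List ℤ → Bool
  P w = h (isEven (neg w)) (exc w)
  e = exc π
  b = isEven (neg π)
  excπ : e ≡ sumBelow m (excAt π)
  excπ = exc≡sumBelow π m (length≡ sp)
  appended₊ : P (insert m π (append true)) ≡ h b e
  appended₊ = cong₂ h (parity-insert m π (append true) sp tt) (trans (exc-append m π true sp) (+-identityʳ e))
  appended₋ : P (insert m π (append false)) ≡ h (not b) (suc e)
  appended₋ = cong₂ h (parity-insert m π (append false) sp tt) (trans (exc-append m π false sp) (+-comm e 1))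
  pair : ∀ i → i < m → bothSigns (P ∘ insert m π) i ≡ excAt π i * bothParities h b e + (1 ∸ excAt π i) * bothParities h b (suc e)
  pair i i<m = trans (cong₂ (λ u v → 𝟙 u + (𝟙 v + 0))
                        (cong₂ h (parity-insert m π (displace i true) sp i<m) (exc-displace sp i true i<m))
                        (cong₂ h (parity-insert m π (displace i false) sp i<m) (exc-displace sp i false i<m)))
                     (bothParities-split h b e (excAt π i) (excAt≤1 sp i i<m))
  displaced : sumBelow m (bothSigns (P ∘ insert m π)) ≡ e * bothParities h b e + (m ∸ e) * bothParities h b (suc e)
  displaced = begin
      sumBelow m (bothSigns (P ∘ insert m π))
        ≡⟨ sumBelow-cong m pair ⟩
      sumBelow m (λ i → excAt π i * bothParities h b e + (1 ∸ excAt π i) * bothParities h b (suc e))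
        ≡⟨ sumBelow-+ m _ _ ⟩
      sumBelow m (λ i → excAt π i * bothParities h b e) + sumBelow m (λ i → (1 ∸ excAt π i) * bothParities h b (suc e))
        ≡⟨ cong₂ _+_ (sumBelow-*ʳ m _ (excAt π)) (sumBelow-*ʳ m _ (λ i → 1 ∸ excAt π i)) ⟩
      sumBelow m (excAt π) * bothParities h b e + sumBelow m (λ i → 1 ∸ excAt π i) * bothParities h b (suc e)
        ≡⟨ cong₂ (λ u v → u * bothParities h b e + v * bothParities h b (suc e))
                 (sym excπ) (trans (sumBelow-complement m (excAt π) (excAt≤1 sp)) (cong (m ∸_) (sym excπ))) ⟩
      e * bothParities h b e + (m ∸ e) * bothParities h b (suc e) ∎

monomial : Bool → ℕ → ℕ → Poly
monomial b u e i j = 𝟙 (b ∧ (eqℕ u i ∧ eqℕ e j))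

recurrence : Poly → Poly → Poly → Poly
recurrence X Y Z = sMul X ⊕ tMul Y ⊕ sMul (tMul (Dop Z))

*-𝟙-eqℕˡ : ∀ c d X → c * 𝟙 (eqℕ c d ∧ X) ≡ d * 𝟙 (eqℕ c d ∧ X)
*-𝟙-eqℕˡ c d X with c ℕ.≟ d
... | yes refl = refl
... | no  c≢d  = trans (*-zeroʳ c) (sym (*-zeroʳ d))

*-𝟙-eqℕʳ : ∀ c d X → c * 𝟙 (X ∧ eqℕ c d) ≡ d * 𝟙 (X ∧ eqℕ c d)
*-𝟙-eqℕʳ c d X = trans (cong (λ z → c * 𝟙 z) (∧-comm X _)) (trans (*-𝟙-eqℕˡ c d X) (cong (λ z → d * 𝟙 z) (∧-comm _ X)))

-- The recurrence applied to monomials: s·s^u t^e = s^{u+1} t^e,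
-- t·s^u t^e = s^u t^{e+1}, and st·D(s^u t^e) = e·s^{u+1} t^e + u·s^u t^{e+1}.
recurrence-monomial : ∀ u e b₁ b₂ i j →
  𝟙 (b₁ ∧ (eqℕ (suc u) i ∧ eqℕ e j)) + (𝟙 (b₂ ∧ (eqℕ u i ∧ eqℕ (suc e) j))
    + (e * 𝟙 (eqℕ (suc u) i ∧ eqℕ e j) + u * 𝟙 (eqℕ u i ∧ eqℕ (suc e) j)))
  ≡ recurrence (monomial b₁ u e) (monomial b₂ u e) (monomial true u e) i j
recurrence-monomial u e b₁ b₂ zero zero
  rewrite eqℕ-suc-zero u | eqℕ-suc-zero e | ∧-zeroʳ b₁ | ∧-zeroʳ (eqℕ u 0) | ∧-zeroʳ b₂ | *-zeroʳ e | *-zeroʳ u = refl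
recurrence-monomial u e b₁ b₂ zero (suc j)
  rewrite eqℕ-suc-zero u | eqℕ-suc e j | ∧-zeroʳ b₁ | *-zeroʳ e | *-𝟙-eqℕˡ u 0 (eqℕ e j) = refl
recurrence-monomial u e b₁ b₂ (suc i) zero
  rewrite eqℕ-suc u i | eqℕ-suc-zero e | ∧-zeroʳ (eqℕ u (suc i)) | ∧-zeroʳ b₂ | *-zeroʳ u | *-𝟙-eqℕʳ e 0 (eqℕ u i)
  = trans (+-identityʳ _) (sym (trans (+-identityʳ _) (+-identityʳ _)))
recurrence-monomial u e b₁ b₂ (suc i) (suc j)
  rewrite eqℕ-suc u i | eqℕ-suc e j | *-𝟙-eqℕʳ e (suc j) (eqℕ u i) | *-𝟙-eqℕˡ u (suc i) (eqℕ e j)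
  = reassociate (𝟙 (b₁ ∧ (eqℕ u i ∧ eqℕ e (suc j)))) (𝟙 (b₂ ∧ (eqℕ u (suc i) ∧ eqℕ e j)))
                 (suc j * 𝟙 (eqℕ u i ∧ eqℕ e (suc j))) (suc i * 𝟙 (eqℕ u (suc i) ∧ eqℕ e j))
  where
  reassociate : ∀ a b c d → a + (b + (c + d)) ≡ a + b + (d + c)
  reassociate a b c d = trans (sym (+-assoc a b (c + d))) (cong (a + b +_) (+-comm c d))

_≗ᴾ_ : Poly → Poly → Set
P ≗ᴾ Q = ∀ i j → P i j ≡ Q i j

sumPoly : List (List ℤ) → (List ℤ → Poly) → Poly
sumPoly L F i j = sumOver (λ π → F π i j) L

sMul-cong : ∀ {P Q} → P ≗ᴾ Q → sMul P ≗ᴾ sMul Q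
sMul-cong P≗Q zero    j = refl
sMul-cong P≗Q (suc i) j = P≗Q i j

tMul-cong : ∀ {P Q} → P ≗ᴾ Q → tMul P ≗ᴾ tMul Q
tMul-cong P≗Q i zero    = refl
tMul-cong P≗Q i (suc j) = P≗Q i j

Dop-cong : ∀ {P Q} → P ≗ᴾ Q → Dop P ≗ᴾ Dop Q
Dop-cong P≗Q i j = cong₂ _+_ (cong (suc i *_) (P≗Q (suc i) j)) (cong (suc j *_) (P≗Q i (suc j)))

recurrence-cong : ∀ {X X′ Y Y′ Z Z′} → X ≗ᴾ X′ → Y ≗ᴾ Y′ → Z ≗ᴾ Z′ → recurrence X Y Z ≗ᴾ recurrence X′ Y′ Z′
recurrence-cong X≗ Y≗ Z≗ i j =
  cong₂ _+_ (cong₂ _+_ (sMul-cong X≗ i j) (tMul-cong Y≗ i j)) (sMul-cong (tMul-cong (Dop-cong Z≗)) i j)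

sMul-sumPoly : ∀ L F → sMul (sumPoly L F) ≗ᴾ sumPoly L (sMul ∘ F)
sMul-sumPoly L F zero    j = sym (sumOver-zero L)
sMul-sumPoly L F (suc i) j = refl

tMul-sumPoly : ∀ L F → tMul (sumPoly L F) ≗ᴾ sumPoly L (tMul ∘ F)
tMul-sumPoly L F i zero    = sym (sumOver-zero L)
tMul-sumPoly L F i (suc j) = refl

Dop-sumPoly : ∀ L F → Dop (sumPoly L F) ≗ᴾ sumPoly L (Dop ∘ F)
Dop-sumPoly L F i j = sym (trans (sumOver-+ _ _ L)
  (cong₂ _+_ (sumOver-*ˡ (suc i) (λ π → F π (suc i) j) L) (sumOver-*ˡ (suc j) (λ π → F π i (suc j)) L)))

recurrence-sumPoly : ∀ L F G H → recurrence (sumPoly L F) (sumPoly L G) (sumPoly L H) ≗ᴾ sumPoly L (λ π → recurrence (F π) (G π) (H π))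
recurrence-sumPoly L F G H i j = trans
  (cong₂ _+_ (cong₂ _+_ (sMul-sumPoly L F i j) (tMul-sumPoly L G i j)) stD)
  (trans (cong (_+ _) (sym (sumOver-+ _ _ L))) (sym (sumOver-+ _ _ L)))
  where
  stD : sMul (tMul (Dop (sumPoly L H))) i j ≡ sumPoly L (λ π → sMul (tMul (Dop (H π)))) i j
  stD = trans (sMul-cong (tMul-cong (Dop-sumPoly L H)) i j)
          (trans (sMul-cong (tMul-sumPoly L (Dop ∘ H)) i j) (sMul-sumPoly L (tMul ∘ Dop ∘ H) i j))

hasParity : Bool → List ℤ → Bool
hasParity b w = sameAs b (isEven (neg w))

-- DExc for b = true and (B-D)Exc for b = false.
parityExc : Bool → ℕ → Poly
parityExc b n i j = count (λ w → hasParity b w ∧ (eqℕ (nexc n w) i ∧ eqℕ (exc w) j)) (Bn n)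

DExc≗parityExc : ∀ n → DExc n ≗ᴾ parityExc true n
DExc≗parityExc n i j = trans (length-filter _ (Dn n)) (count-filter _ (λ w → isEven (neg w)) (Bn n))

BDExc≗parityExc : ∀ n → BDExc n ≗ᴾ parityExc false n
BDExc≗parityExc n i j = trans (length-filter _ (BDn n)) (count-filter _ (λ w → not (isEven (neg w))) (Bn n))

excMonomial : Bool → ℕ → List ℤ → Poly
excMonomial b n π = monomial b (n ∸ exc π) (exc π)

parityExc≗sumPoly : ∀ b n → parityExc b n ≗ᴾ sumPoly (Bn n) (λ π → excMonomial (hasParity b π) n π)
parityExc≗sumPoly b n i j = count≡sumOver _ (Bn n)

BExc≗sumPoly : ∀ n → BExc n ≗ᴾ sumPoly (Bn n) (excMonomial true n)
BExc≗sumPoly n i j = trans (length-filter _ (Bn n)) (count≡sumOver _ (Bn n))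

𝟙-∧-either : ∀ c q → 𝟙 (c ∧ q) + (𝟙 (not c ∧ q) + 0) ≡ 𝟙 q
𝟙-∧-either true  q = +-identityʳ (𝟙 q)
𝟙-∧-either false q = +-identityʳ (𝟙 q)

sameAs-not : ∀ b p → sameAs b (not p) ≡ sameAs (not b) p
sameAs-not true  p = refl
sameAs-not false p = not-involutive p

recurrence-children : ∀ b m π i j → IsSignedPerm m π →
  count (λ w → hasParity b w ∧ (eqℕ (nexc (suc m) w) i ∧ eqℕ (exc w) j)) (children m π)
  ≡ recurrence (excMonomial (hasParity b π) m π) (excMonomial (hasParity (not b) π) m π) (excMonomial true m π) i j
recurrence-children b m π i j sp = begin
    count (λ w → h (isEven (neg w)) (exc w)) (children m π)
      ≡⟨ count-children m π h sp ⟩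
    𝟙 (h p e) + (𝟙 (h (not p) (suc e)) + (e * bothParities h p e + (m ∸ e) * bothParities h p (suc e)))
      ≡⟨ cong₂ (λ x y → 𝟙 (h p e) + (𝟙 (h (not p) (suc e)) + (e * x + (m ∸ e) * y))) (collapse e) (collapse (suc e)) ⟩
    𝟙 (h p e) + (𝟙 (h (not p) (suc e)) + (e * 𝟙 (q e) + (m ∸ e) * 𝟙 (q (suc e))))
      ≡⟨ cong₂ (λ x c → 𝟙 (sameAs b p ∧ (eqℕ x i ∧ eqℕ e j)) + (𝟙 (c ∧ q (suc e)) + (e * 𝟙 (eqℕ x i ∧ eqℕ e j) + (m ∸ e) * 𝟙 (q (suc e)))))
               (+-∸-assoc 1 (exc≤size sp)) (sameAs-not b p) ⟩
    𝟙 (sameAs b p ∧ (eqℕ (suc (m ∸ e)) i ∧ eqℕ e j)) + (𝟙 (sameAs (not b) p ∧ (eqℕ (m ∸ e) i ∧ eqℕ (suc e) j))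
      + (e * 𝟙 (eqℕ (suc (m ∸ e)) i ∧ eqℕ e j) + (m ∸ e) * 𝟙 (eqℕ (m ∸ e) i ∧ eqℕ (suc e) j)))
      ≡⟨ recurrence-monomial (m ∸ e) e (sameAs b p) (sameAs (not b) p) i j ⟩
    recurrence (excMonomial (hasParity b π) m π) (excMonomial (hasParity (not b) π) m π) (excMonomial true m π) i j ∎
  where
  open ≡-Reasoning
  e = exc π
  p = isEven (neg π)
  q : ℕ → Bool
  q x = eqℕ (suc m ∸ x) i ∧ eqℕ x j
  h : Bool → ℕ → Bool
  h p′ x = sameAs b p′ ∧ q x
  -- sameAs b (not p) is not (sameAs b p), so exactly one parity matches
  collapse : ∀ x → bothParities h p x ≡ 𝟙 (q x)
  collapse x = by-target b
    where
    by-target : ∀ b → 𝟙 (sameAs b p ∧ q x) + (𝟙 (sameAs b (not p) ∧ q x) + 0) ≡ 𝟙 (q x)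
    by-target true  = 𝟙-∧-either p (q x)
    by-target false = 𝟙-∧-either (not p) (q x)

parityExc-recurrence : ∀ b m → parityExc b (suc m) ≗ᴾ recurrence (parityExc b m) (parityExc (not b) m) (BExc m)
parityExc-recurrence b m i j = begin
    parityExc b (suc m) i j
      ≡⟨ count-Bn-suc m _ ⟩
    sumOver (λ π → count (λ w → hasParity b w ∧ (eqℕ (nexc (suc m) w) i ∧ eqℕ (exc w) j)) (children m π)) (Bn m)
      ≡⟨ sumOver-congᴬˡˡ (Bn m) (Bn-signedPerms m) (λ π sp → recurrence-children b m π i j sp) ⟩
    sumPoly (Bn m) (λ π → recurrence (excMonomial (hasParity b π) m π) (excMonomial (hasParity (not b) π) m π) (excMonomial true m π)) i j
      ≡⟨ sym (recurrence-sumPoly (Bn m) (λ π → excMonomial (hasParity b π) m π) (λ π → excMonomial (hasParity (not b) π) m π) (excMonomial true m) i j) ⟩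
    recurrence (sumPoly (Bn m) (λ π → excMonomial (hasParity b π) m π)) (sumPoly (Bn m) (λ π → excMonomial (hasParity (not b) π) m π))
               (sumPoly (Bn m) (excMonomial true m)) i j
      ≡⟨ sym (recurrence-cong (parityExc≗sumPoly b m) (parityExc≗sumPoly (not b) m) (BExc≗sumPoly m) i j) ⟩
    recurrence (parityExc b m) (parityExc (not b) m) (BExc m) i j ∎
  where open ≡-Reasoning

lemma28 : (n : ℕ) → 2 ≤ n →
    ((i j : ℕ) → DExc n i j ≡ (sMul (DExc (n ∸ 1)) ⊕ tMul (BDExc (n ∸ 1)) ⊕ sMul (tMul (Dop (BExc (n ∸ 1))))) i j)
    × ((i j : ℕ) → BDExc n i j ≡ (tMul (DExc (n ∸ 1)) ⊕ sMul (BDExc (n ∸ 1)) ⊕ sMul (tMul (Dop (BExc (n ∸ 1))))) i j)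
lemma28 (suc (suc m′)) (s≤s (s≤s z≤n)) = D-recurrence , BD-recurrence
  where
  m = suc m′
  D-recurrence : DExc (suc m) ≗ᴾ recurrence (DExc m) (BDExc m) (BExc m)
  D-recurrence i j = begin
    DExc (suc m) i j                                               ≡⟨ DExc≗parityExc (suc m) i j ⟩
    parityExc true (suc m) i j                                     ≡⟨ parityExc-recurrence true m i j ⟩
    recurrence (parityExc true m) (parityExc false m) (BExc m) i j ≡⟨ sym (recurrence-cong {Z = BExc m} (DExc≗parityExc m) (BDExc≗parityExc m) (λ _ _ → refl) i j) ⟩
    recurrence (DExc m) (BDExc m) (BExc m) i j                     ∎
    where open ≡-Reasoning
  BD-recurrence : BDExc (suc m) ≗ᴾ (tMul (DExc m) ⊕ sMul (BDExc m) ⊕ sMul (tMul (Dop (BExc m))))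
  BD-recurrence i j = begin
    BDExc (suc m) i j                                              ≡⟨ BDExc≗parityExc (suc m) i j ⟩
    parityExc false (suc m) i j                                    ≡⟨ parityExc-recurrence false m i j ⟩
    recurrence (parityExc false m) (parityExc true m) (BExc m) i j ≡⟨ sym (recurrence-cong {Z = BExc m} (BDExc≗parityExc m) (DExc≗parityExc m) (λ _ _ → refl) i j) ⟩
    recurrence (BDExc m) (DExc m) (BExc m) i j                     ≡⟨ cong (_+ sMul (tMul (Dop (BExc m))) i j) (+-comm (sMul (BDExc m) i j) _) ⟩
    (tMul (DExc m) ⊕ sMul (BDExc m) ⊕ sMul (tMul (Dop (BExc m)))) i j ∎
    where open ≡-Reasoning
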